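{- Let $n,k$ be integers with $n \ge 2k+1 \ge 7$. Let $i$ be an integer with $1 \le i \le n-k+1$, and $l$ an integer with $1 \le l \le \binom{n-i}{k-1}$. Let $d_i = \lfloor \binom{n-i}{k-1}/l \rfloor$. Then $\mathcal{A}_i(n,k)$ can be partitioned into families $\mathcal{A}^l_{i1}(n,k), \mathcal{A}^l_{i2}(n,k), \ldots, \mathcal{A}^l_{id_i}(n,k)$, each of size exactly $l$, together with a family $\mathcal{A}^l_{i,d_i+1}(n,k)$ of size $\binom{n-i}{k-1} - d_i l$ when $\binom{n-i}{k-1}$ is not divisible by $l$, such that for each $1 \le j \le d_i$ the members of $\mathcal{A}^l_{ij}(n,k)$ cover at least $\min\{n-i+1,\ l(k-1)+1\}$ labels of $[n]$.
   Context: $[n]=\{1,2,\dots,n\}$; its elements are called labels. For $1 \le i \le n-k+1$, $\mathcal{A}_i(n,k)$ denotes the family of all $k$-subsets of $[n]$ whose smallest element is $i$, i.e. $\{A \subseteq [n] : |A|=k,\ i \in A,\ A\setminus\{i\} \subseteq \{i+1,\dots,n\}\}$; it has $\binom{n-i}{k-1}$ members. A label is covered by a family of $k$-subsets if it belongs to at least one member of the family. -}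

module Defs where

open import Data.Nat using (ℕ; suc; _≤_; _∸_; _+_; _*_; _⊓_)
open import Data.Fin using (Fin; toℕ)
open import Data.Fin.Subset using (Subset; _∈_; ∣_∣; ⋃)
open import Data.Product using (Σ; _×_)
open import Data.List using (List)
open import Relation.Binary.PropositionalEquality using (_≡_)

-- Labels: the label represented by x : Fin n is suc (toℕ x) ∈ [n] = {1,…,n}.
label : {n : ℕ} → Fin n → ℕ
label x = suc (toℕ x)

-- A ∈ 𝒜_i(n,k): A is a k-subset of [n] whose smallest label is i.
InFamily : (n k i : ℕ) → Subset n → Set
InFamily n k i A =
  (∣ A ∣ ≡ k) × (Σ (Fin n) λ x → (x ∈ A) × (label x ≡ i))
               × (∀ (y : Fin n) → y ∈ A → i ≤ label y)

covered : {n : ℕ} → List (Subset n) → ℕ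
covered F = ∣ ⋃ F ∣

-- A k-set with least element i is {i} ∪ B for an r-subset B (r = k - 1) of the m = n - i labels
-- above i, so the theorem is Baranyai's theorem, in its general form, for the r-subsets of an m-set.
-- The C(m, r) sets are grown in slots, l consecutive slots forming a block, one element at a time:
-- after p elements every X of size at most r is the partial set of exactly C(m - p, r - |X|) slots.
-- The next element goes to a slot with partial set X with "probability" (r - |X|) / (m - p); by
-- absorption these fractions add up to integers over the slots of each type X, and, after padding,
-- over each block. Rounding this fractional bipartite matching by cycle cancelling keeps the counts
-- for every type and gives every block its expected number of copies of the element, rounded up or
-- down; this keeps a block disjoint while l r ≤ m and makes it cover all m elements otherwise.

module Submission where

open import Data.Nat using (ℕ; _<_)
open import Relation.Binary using (DecidableEquality)

module Sums where

  open import Data.Bool using (Bool; if_then_else_)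
  open import Data.Empty using (⊥; ⊥-elim)
  open import Data.Nat
  open import Data.Nat.Divisibility using (_∣_; divides; ∣m∣n⇒∣m+n; ∣m+n∣m⇒∣n)
  open import Data.Nat.Properties
  open import Algebra.Properties.CommutativeSemigroup +-commutativeSemigroup using (interchange)
  open import Data.Product using (Σ; _×_; _,_; proj₂)
  open import Relation.Binary.PropositionalEquality
  open import Relation.Nullary using (Dec; yes; no; ¬_)

  ∑ : ℕ → ℕ → (ℕ → ℕ) → ℕ
  ∑ a zero    f = 0
  ∑ a (suc n) f = f a + ∑ (suc a) n f

  when : Bool → ℕ → ℕ
  when b v = if b then v else 0

  -- matching on the decision itself (rather than on `does`) keeps `with x ≟ y` effective on `when? (x ≟ y) v`
  when? : ∀ {p} {P : Set p} → Dec P → ℕ → ℕ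
  when? (yes _) v = v
  when? (no  _) v = 0

  when?-zero : ∀ {p} {P : Set p} (d : Dec P) → when? d 0 ≡ 0
  when?-zero (yes _) = refl
  when?-zero (no  _) = refl

  when?≤ : ∀ {p} {P : Set p} (d : Dec P) v → when? d v ≤ v
  when?≤ (yes _) v = ≤-refl
  when?≤ (no  _) v = z≤n

  when?-yes : ∀ {p} {P : Set p} → P → (d : Dec P) → ∀ v → when? d v ≡ v
  when?-yes _  (yes _) v = refl
  when?-yes p  (no ¬p) v = ⊥-elim (¬p p)

  when?-no : ∀ {p} {P : Set p} → ¬ P → (d : Dec P) → ∀ v → when? d v ≡ 0
  when?-no ¬p (yes p) v = ⊥-elim (¬p p)
  when?-no _  (no  _) v = refl

  unless? : ∀ {p} {P : Set p} → Dec P → ℕ → ℕ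
  unless? (yes _) v = 0
  unless? (no  _) v = v

  private
    variable
      a k n c N : ℕ
      f g : ℕ → ℕ

    widen : suc a ≤ k → k < suc a + n → a ≤ k × k < a + suc n
    widen {a} {k} {n} a<k k< = ≤-trans (n≤1+n a) a<k , subst (k <_) (sym (+-suc a n)) k<

    narrow : a ≤ k → a ≢ k → k < a + suc n → suc a ≤ k × k < suc a + n
    narrow {a} {k} {n} a≤k a≢k k< = ≤∧≢⇒< a≤k a≢k , subst (k <_) (+-suc a n) k<

    first : ∀ a n → a < a + suc n
    first a n = m<m+n a z<s

    empty : a ≤ k → k < a + 0 → ⊥
    empty {a} a≤k k< = <-irrefl refl (<-≤-trans k< (subst (_≤ _) (sym (+-identityʳ a)) a≤k))

  ∑-cong : ∀ a n → (∀ k → a ≤ k → k < a + n → f k ≡ g k) → ∑ a n f ≡ ∑ a n g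
  ∑-cong a zero    eq = refl
  ∑-cong a (suc n) eq = cong₂ _+_ (eq a ≤-refl (first a n))
    (∑-cong (suc a) n (λ k a<k k< → let a≤k , k<′ = widen a<k k< in eq k a≤k k<′))

  ∑-cong′ : ∀ a n → f ≗ g → ∑ a n f ≡ ∑ a n g
  ∑-cong′ a n eq = ∑-cong a n (λ k _ _ → eq k)

  ∑-zero : ∀ a n → (∀ k → a ≤ k → k < a + n → f k ≡ 0) → ∑ a n f ≡ 0
  ∑-zero a zero    eq = refl
  ∑-zero a (suc n) eq rewrite eq a ≤-refl (first a n) =
    ∑-zero (suc a) n (λ k a<k k< → let a≤k , k<′ = widen a<k k< in eq k a≤k k<′)

  ∑-const : ∀ a n c → ∑ a n (λ _ → c) ≡ n * c
  ∑-const a zero    c = refl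
  ∑-const a (suc n) c = cong (c +_) (∑-const (suc a) n c)

  ∑-distrib-+ : ∀ a n (f g : ℕ → ℕ) → ∑ a n (λ k → f k + g k) ≡ ∑ a n f + ∑ a n g
  ∑-distrib-+ a zero    f g = refl
  ∑-distrib-+ a (suc n) f g =
    trans (cong (f a + g a +_) (∑-distrib-+ (suc a) n f g)) (interchange (f a) (g a) _ _)

  ∑-*ˡ : ∀ a n c (f : ℕ → ℕ) → ∑ a n (λ k → c * f k) ≡ c * ∑ a n f
  ∑-*ˡ a zero    c f = sym (*-zeroʳ c)
  ∑-*ˡ a (suc n) c f =
    trans (cong (c * f a +_) (∑-*ˡ (suc a) n c f)) (sym (*-distribˡ-+ c (f a) _))

  ∑-++ : ∀ a m n (f : ℕ → ℕ) → ∑ a (m + n) f ≡ ∑ a m f + ∑ (a + m) n f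
  ∑-++ a zero    n f = cong (λ b → ∑ b n f) (sym (+-identityʳ a))
  ∑-++ a (suc m) n f = trans (cong (f a +_) (trans (∑-++ (suc a) m n f)
    (cong (λ b → ∑ (suc a) m f + ∑ b n f) (sym (+-suc a m))))) (sym (+-assoc (f a) _ _))

  ∑-shift : ∀ a n (f : ℕ → ℕ) → ∑ (suc a) n f ≡ ∑ a n (λ k → f (suc k))
  ∑-shift a zero    f = refl
  ∑-shift a (suc n) f = cong (f (suc a) +_) (∑-shift (suc a) n f)

  ∑-from-0 : ∀ a n (f : ℕ → ℕ) → ∑ a n f ≡ ∑ 0 n (λ t → f (a + t))
  ∑-from-0 zero    n f = refl
  ∑-from-0 (suc a) n f = trans (∑-shift a n f) (∑-from-0 a n (λ k → f (suc k)))

  ∑-last : ∀ a n (f : ℕ → ℕ) → ∑ a (suc n) f ≡ ∑ a n f + f (a + n)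
  ∑-last a n f = trans (cong (λ m → ∑ a m f) (+-comm 1 n))
    (trans (∑-++ a n 1 f) (cong (∑ a n f +_) (+-identityʳ _)))

  ∑-rotate : ∀ a n (f : ℕ → ℕ) → f a ≡ f (a + n) → ∑ a n f ≡ ∑ (suc a) n f
  ∑-rotate a zero    f _  = refl
  ∑-rotate a (suc n) f eq = begin
    f a + ∑ (suc a) n f             ≡⟨ +-comm (f a) _ ⟩
    ∑ (suc a) n f + f a             ≡⟨ cong (∑ (suc a) n f +_) (trans eq (cong f (+-suc a n))) ⟩
    ∑ (suc a) n f + f (suc a + n)   ≡⟨ ∑-last (suc a) n f ⟨
    ∑ (suc a) (suc n) f             ∎
    where open ≡-Reasoning

  ∑-mono-≤ : ∀ a n → (∀ k → f k ≤ g k) → ∑ a n f ≤ ∑ a n g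
  ∑-mono-≤ a zero    le = z≤n
  ∑-mono-≤ a (suc n) le = +-mono-≤ (le a) (∑-mono-≤ (suc a) n le)

  ∑-mono-< : ∀ a n → (∀ k → f k ≤ g k) → ∀ j → a ≤ j → j < a + n → f j < g j → ∑ a n f < ∑ a n g
  ∑-mono-< a zero    le j a≤j j< _ = ⊥-elim (empty a≤j j<)
  ∑-mono-< a (suc n) le j a≤j j< lt with a ≟ j
  ... | yes refl = +-mono-<-≤ lt (∑-mono-≤ (suc a) n le)
  ... | no  a≢j  = let a<j , j<′ = narrow a≤j a≢j j< in
    +-mono-≤-< (le a) (∑-mono-< (suc a) n le j a<j j<′ lt)

  ∑-comm : ∀ a n b m (h : ℕ → ℕ → ℕ) →
           ∑ a n (λ k → ∑ b m (h k)) ≡ ∑ b m (λ e → ∑ a n (λ k → h k e))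
  ∑-comm a zero    b m h = sym (∑-zero b m (λ _ _ _ → refl))
  ∑-comm a (suc n) b m h = trans (cong (∑ b m (h a) +_) (∑-comm (suc a) n b m h))
    (sym (∑-distrib-+ b m (h a) (λ e → ∑ (suc a) n (λ k → h k e))))

  ∑-∣ : ∀ a n → (∀ k → a ≤ k → k < a + n → N ∣ f k) → N ∣ ∑ a n f
  ∑-∣ a zero    dv = divides 0 refl
  ∑-∣ a (suc n) dv = ∣m∣n⇒∣m+n (dv a ≤-refl (first a n))
    (∑-∣ (suc a) n (λ k a<k k< → let a≤k , k<′ = widen a<k k< in dv k a≤k k<′))

  ∑-point : ∀ a n j (g : ℕ → ℕ) → a ≤ j → j < a + n → ∑ a n (λ k → when? (k ≟ j) (g k)) ≡ g j
  ∑-point a zero    j g a≤j j< = ⊥-elim (empty a≤j j<)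
  ∑-point a (suc n) j g a≤j j< with a ≟ j
  ... | yes refl = trans (cong (g a +_) (∑-zero (suc a) n after)) (+-identityʳ (g a))
    where
    after : ∀ k → suc a ≤ k → k < suc a + n → when? (k ≟ a) (g k) ≡ 0
    after k a<k _ with k ≟ a
    ... | yes refl = ⊥-elim (<-irrefl refl a<k)
    ... | no  _    = refl
  ... | no  a≢j  = let a<j , j<′ = narrow a≤j a≢j j< in ∑-point (suc a) n j g a<j j<′

  ∑-remove : ∀ a n j (f : ℕ → ℕ) → a ≤ j → j < a + n →
             ∑ a n f ≡ f j + ∑ a n (λ k → unless? (k ≟ j) (f k))
  ∑-remove a n j f a≤j j< = begin
    ∑ a n f                                               ≡⟨ ∑-cong′ a n split ⟩
    ∑ a n (λ k → when? (k ≟ j) (f k) + rest k)            ≡⟨ ∑-distrib-+ a n _ rest ⟩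
    ∑ a n (λ k → when? (k ≟ j) (f k)) + ∑ a n rest        ≡⟨ cong (_+ ∑ a n rest) (∑-point a n j f a≤j j<) ⟩
    f j + ∑ a n rest                                      ∎
    where
    open ≡-Reasoning
    rest = λ k → unless? (k ≟ j) (f k)
    split : ∀ k → f k ≡ when? (k ≟ j) (f k) + rest k
    split k with k ≟ j
    ... | yes _ = sym (+-identityʳ (f k))
    ... | no  _ = refl

  term≤∑ : ∀ a n k → a ≤ k → k < a + n → f k ≤ ∑ a n f
  term≤∑ {f} a n k a≤k k< = subst (f k ≤_) (sym (∑-remove a n k f a≤k k<))
    (m≤m+n (f k) (∑ a n (λ i → unless? (i ≟ k) (f i))))

  two-terms≤∑ : ∀ a n j k → a ≤ j → j < a + n → a ≤ k → k < a + n → j ≢ k → f j + f k ≤ ∑ a n f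
  two-terms≤∑ {f} a n j k a≤j j< a≤k k< j≢k = subst (f j + f k ≤_) (sym (∑-remove a n j f a≤j j<))
    (+-monoʳ-≤ (f j) (subst (_≤ ∑ a n rest) kept (term≤∑ {rest} a n k a≤k k<)))
    where
    rest = λ i → unless? (i ≟ j) (f i)
    kept : rest k ≡ f k
    kept with k ≟ j
    ... | yes k≡j = ⊥-elim (j≢k (sym k≡j))
    ... | no  _   = refl

  ∑-∣-remaining : ∀ a n j → a ≤ j → j < a + n → N ∣ ∑ a n f →
                  (∀ k → a ≤ k → k < a + n → k ≢ j → N ∣ f k) → N ∣ f j
  ∑-∣-remaining {N = N} {f = f} a n j a≤j j< dv-sum dv-others =
    ∣m+n∣m⇒∣n (subst (N ∣_) (trans (∑-remove a n j f a≤j j<) (+-comm (f j) _)) dv-sum)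
              (∑-∣ a n dv-rest)
    where
    dv-rest : ∀ k → a ≤ k → k < a + n → N ∣ unless? (k ≟ j) (f k)
    dv-rest k a≤k k< with k ≟ j
    ... | yes _   = divides 0 refl
    ... | no  k≢j = dv-others k a≤k k< k≢j

  ∑-pos : ∀ a n (f : ℕ → ℕ) → 0 < ∑ a n f → Σ ℕ λ k → a ≤ k × k < a + n × 0 < f k
  ∑-pos a zero    f ()
  ∑-pos a (suc n) f pos with f a in eq
  ... | suc _ = a , ≤-refl , first a n , subst (0 <_) (sym eq) z<s
  ... | zero  with ∑-pos (suc a) n f pos
  ...   | k , a<k , k< , fk = let a≤k , k<′ = widen a<k k< in k , a≤k , k<′ , fk

  ∑-≤1 : ∀ a n (f : ℕ → ℕ) → (∀ k → f k ≤ 1) →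
         (∀ j k → a ≤ j → j < k → k < a + n → f j ≡ 1 → f k ≡ 1 → ⊥) → ∑ a n f ≤ 1
  ∑-≤1 a zero    f ≤1 once = z≤n
  ∑-≤1 a (suc n) f ≤1 once with f a in eq | ≤1 a
  ... | zero     | _ = ∑-≤1 (suc a) n f ≤1 (λ j k a<j j<k k< →
    once j k (≤-trans (n≤1+n a) a<j) j<k (proj₂ (widen (<-trans a<j j<k) k<)))
  ... | suc zero | _ = s≤s (≤-reflexive (∑-zero (suc a) n others))
    where
    others : ∀ k → suc a ≤ k → k < suc a + n → f k ≡ 0
    others k a<k k< with f k in eq′ | ≤1 k
    ... | zero     | _ = refl
    ... | suc zero | _ = ⊥-elim (once a k ≤-refl a<k (proj₂ (widen a<k k<)) eq eq′)
    ... | 2+ _     | s≤s ()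
  ... | 2+ _     | s≤s ()

  when?-∑ : ∀ {p} {P : Set p} (d : Dec P) a n (f : ℕ → ℕ) → when? d (∑ a n f) ≡ ∑ a n (λ k → when? d (f k))
  when?-∑ (yes _) a n f = refl
  when?-∑ (no  _) a n f = sym (∑-zero a n (λ _ _ _ → refl))

  -- double counting the pairs (e , k) with ed k ≡ e
  ∑-fibres : ∀ {p} {P : ℕ → Set p} (P? : ∀ e → Dec (P e)) E a n (ed c : ℕ → ℕ) →
             (∀ k → a ≤ k → k < a + n → ed k < E) →
             ∑ 0 E (λ e → when? (P? e) (∑ a n (λ k → when? (e ≟ ed k) (c k)))) ≡
             ∑ a n (λ k → when? (P? (ed k)) (c k))
  ∑-fibres P? E a n ed c ed<E = begin
    ∑ 0 E (λ e → when? (P? e) (∑ a n (λ k → when? (e ≟ ed k) (c k))))   ≡⟨ ∑-cong′ 0 E (λ e → when?-∑ (P? e) a n _) ⟩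
    ∑ 0 E (λ e → ∑ a n (λ k → when? (P? e) (when? (e ≟ ed k) (c k))))   ≡⟨ ∑-comm 0 E a n _ ⟩
    ∑ a n (λ k → ∑ 0 E (λ e → when? (P? e) (when? (e ≟ ed k) (c k))))   ≡⟨ ∑-cong a n fibre ⟩
    ∑ a n (λ k → when? (P? (ed k)) (c k))                                ∎
    where
    open ≡-Reasoning
    move : ∀ k e → when? (P? e) (when? (e ≟ ed k) (c k)) ≡ when? (e ≟ ed k) (when? (P? (ed k)) (c k))
    move k e with e ≟ ed k
    ... | yes refl = refl
    ... | no  _    = when?-zero (P? e)
    fibre : ∀ k → a ≤ k → k < a + n →
            ∑ 0 E (λ e → when? (P? e) (when? (e ≟ ed k) (c k))) ≡ when? (P? (ed k)) (c k)
    fibre k a≤k k< = trans (∑-cong′ 0 E (move k))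
      (∑-point 0 E (ed k) (λ _ → when? (P? (ed k)) (c k)) z≤n (ed<E k a≤k k<))

  when?-≟-sym : ∀ x y v → when? (x ≟ y) v ≡ when? (y ≟ x) v
  when?-≟-sym x y v with x ≟ y | y ≟ x
  ... | yes _   | yes _   = refl
  ... | no  _   | no  _   = refl
  ... | yes x≡y | no  y≢x = ⊥-elim (y≢x (sym x≡y))
  ... | no  x≢y | yes y≡x = ⊥-elim (x≢y (sym y≡x))

module Search where

  open import Data.Nat
  open import Data.Nat.Induction using (<-rec)
  open import Data.Nat.Properties
  open import Data.Product using (Σ; _×_; _,_)
  open import Level using (0ℓ)
  open import Relation.Binary.PropositionalEquality
  open import Relation.Nullary using (Dec; yes; no; ¬_)
  open import Relation.Unary using (Pred; Decidable)

  least : ∀ {P : Pred ℕ 0ℓ} → Decidable P → ∀ {n} → P n → Σ ℕ λ j → P j × (∀ k → k < j → ¬ P k)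
  least {P} P? {n} = <-rec (λ n → P n → Σ ℕ λ j → P j × (∀ k → k < j → ¬ P k)) step n
    where
    step : ∀ n → (∀ {m} → m < n → P m → Σ ℕ λ j → P j × (∀ k → k < j → ¬ P k)) →
           P n → Σ ℕ λ j → P j × (∀ k → k < j → ¬ P k)
    step n rec pn with anyUpTo? P? n
    ... | yes (m , m<n , pm) = rec m<n pm
    ... | no  none           = n , pn , λ k k<n pk → none (k , k<n , pk)

  minimizer : ∀ a n (f : ℕ → ℕ) →
              Σ ℕ λ k → a ≤ k × k < a + suc n × (∀ j → a ≤ j → j < a + suc n → f k ≤ f j)
  minimizer a zero    f = a , ≤-refl , m<m+n a z<s , λ j a≤j j< →
    ≤-reflexive (cong f (≤-antisym a≤j (≤-pred (subst (j <_) (+-comm a 1) j<))))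
  minimizer a (suc n) f with minimizer (suc a) n f
  ... | k , a<k , k< , k-min = choose (f a ≤? f k)
    where
    shift : ∀ {j} → j < suc a + suc n → j < a + suc (suc n)
    shift {j} = subst (j <_) (sym (+-suc a (suc n)))
    unshift : ∀ {j} → a ≢ j → j < a + suc (suc n) → j < suc a + suc n
    unshift {j} _ = subst (j <_) (+-suc a (suc n))
    choose : Dec (f a ≤ f k) →
             Σ ℕ λ k → a ≤ k × k < a + suc (suc n) × (∀ j → a ≤ j → j < a + suc (suc n) → f k ≤ f j)
    choose (yes fa≤fk) = a , ≤-refl , m<m+n a z<s , fa-min
      where
      fa-min : ∀ j → a ≤ j → j < a + suc (suc n) → f a ≤ f j
      fa-min j a≤j j< with a ≟ j
      ... | yes refl = ≤-refl
      ... | no  a≢j  = ≤-trans fa≤fk (k-min j (≤∧≢⇒< a≤j a≢j) (unshift a≢j j<))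
    choose (no fa≰fk) = k , <⇒≤ a<k , shift k< , fk-min
      where
      fk-min : ∀ j → a ≤ j → j < a + suc (suc n) → f k ≤ f j
      fk-min j a≤j j< with a ≟ j
      ... | yes refl = <⇒≤ (≰⇒> fa≰fk)
      ... | no  a≢j  = k-min j (≤∧≢⇒< a≤j a≢j) (unshift a≢j j<)

module Binomial where

  open import Data.Nat
  open import Data.Nat.Combinatorics using (_C_; nCk+nC[k+1]≡[n+1]C[k+1]; nC1≡n)
  open import Data.Nat.Properties
  open import Data.Nat.Solver using (module +-*-Solver)
  open import Relation.Binary.PropositionalEquality

  [1+n]C[1+k]*[1+k]≡[1+n]*nCk : ∀ n k → (suc n C suc k) * suc k ≡ suc n * (n C k)
  [1+n]C[1+k]*[1+k]≡[1+n]*nCk zero    zero    = refl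
  [1+n]C[1+k]*[1+k]≡[1+n]*nCk zero    (suc k) = refl
  [1+n]C[1+k]*[1+k]≡[1+n]*nCk (suc n) zero    = begin
    (2+ n C 1) * 1   ≡⟨ *-identityʳ (2+ n C 1) ⟩
    2+ n C 1         ≡⟨ nC1≡n (2+ n) ⟩
    2+ n             ≡⟨ *-identityʳ (2+ n) ⟨
    2+ n * 1         ∎
    where open ≡-Reasoning
  [1+n]C[1+k]*[1+k]≡[1+n]*nCk (suc n) (suc k) = begin
    (2+ n C 2+ k) * 2+ k                ≡⟨ cong (_* 2+ k) (nCk+nC[k+1]≡[n+1]C[k+1] (suc n) (suc k)) ⟨
    (X + Y) * 2+ k                      ≡⟨ expand X Y k ⟩
    X * suc k + X + Y * 2+ k            ≡⟨ cong₂ (λ x y → x + X + y) ([1+n]C[1+k]*[1+k]≡[1+n]*nCk n k)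
                                                                     ([1+n]C[1+k]*[1+k]≡[1+n]*nCk n (suc k)) ⟩
    suc n * a + X + suc n * c           ≡⟨ cong (λ x → suc n * a + x + suc n * c) (nCk+nC[k+1]≡[n+1]C[k+1] n k) ⟨
    suc n * a + (a + c) + suc n * c     ≡⟨ collect n a c ⟩
    2+ n * (a + c)                      ≡⟨ cong (2+ n *_) (nCk+nC[k+1]≡[n+1]C[k+1] n k) ⟩
    2+ n * X                            ∎
    where
    open ≡-Reasoning
    open +-*-Solver
    X = suc n C suc k
    Y = suc n C 2+ k
    a = n C k
    c = n C suc k
    expand : ∀ X Y k → (X + Y) * 2+ k ≡ X * suc k + X + Y * 2+ k
    expand = solve 3 (λ X Y k → (X :+ Y) :* (con 2 :+ k) := X :* (con 1 :+ k) :+ X :+ Y :* (con 2 :+ k)) refl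
    collect : ∀ n a c → suc n * a + (a + c) + suc n * c ≡ 2+ n * (a + c)
    collect = solve 3 (λ n a c → (con 1 :+ n) :* a :+ (a :+ c) :+ (con 1 :+ n) :* c := (con 2 :+ n) :* (a :+ c)) refl

module SubsetSums where

  open import Data.Bool using (Bool; true; false)
  import Data.Bool as Bool
  open import Data.Empty using (⊥-elim)
  open import Data.Fin.Subset using (Subset)
  open import Data.Nat
  open import Data.Nat.Divisibility using (_∣_; ∣m∣n⇒∣m+n)
  open import Data.Nat.Properties using (+-identityʳ)
  open import Data.Vec using ([]; _∷_)
  open import Data.Vec.Properties using (∷-injectiveˡ; ∷-injectiveʳ)
  import Data.Vec.Properties as Vec
  open import Relation.Binary using (DecidableEquality)
  open import Relation.Binary.PropositionalEquality
  open import Relation.Nullary using (yes; no)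
  open Sums

  private
    variable
      p : ℕ

  abstract
    _≟ˢ_ : DecidableEquality (Subset p)
    _≟ˢ_ = Vec.≡-dec Bool._≟_

  when?-∷ : ∀ c (Y : Subset p) b X (v : ℕ) →
            when? ((c ∷ Y) ≟ˢ (b ∷ X)) v ≡ when? (Y ≟ˢ X) (when? (c Bool.≟ b) v)
  when?-∷ c Y b X v with (c ∷ Y) ≟ˢ (b ∷ X) | Y ≟ˢ X | c Bool.≟ b
  ... | yes _  | yes _    | yes _    = refl
  ... | yes eq | yes _    | no c≢b   = ⊥-elim (c≢b (∷-injectiveˡ eq))
  ... | yes eq | no  Y≢X  | _        = ⊥-elim (Y≢X (∷-injectiveʳ eq))
  ... | no neq | yes refl | yes refl = ⊥-elim (neq refl)
  ... | no _   | yes _    | no _     = refl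
  ... | no _   | no  _    | _        = refl

  ∑ˢ : (Subset p → ℕ) → ℕ
  ∑ˢ {zero}  g = g []
  ∑ˢ {suc p} g = ∑ˢ (λ X → g (false ∷ X)) + ∑ˢ (λ X → g (true ∷ X))

  ∑ˢ-cong : ∀ {g h : Subset p → ℕ} → (∀ X → g X ≡ h X) → ∑ˢ g ≡ ∑ˢ h
  ∑ˢ-cong {zero}  eq = eq []
  ∑ˢ-cong {suc p} eq = cong₂ _+_ (∑ˢ-cong (λ X → eq (false ∷ X))) (∑ˢ-cong (λ X → eq (true ∷ X)))

  ∑ˢ-point : ∀ (Y : Subset p) (g : Subset p → ℕ) → ∑ˢ (λ X → when? (Y ≟ˢ X) (g X)) ≡ g Y
  ∑ˢ-point [] g with [] ≟ˢ []
  ... | yes _  = refl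
  ... | no []≢ = ⊥-elim ([]≢ refl)
  ∑ˢ-point (c ∷ Y) g = begin
    ∑ˢ (λ X → when? ((c ∷ Y) ≟ˢ (false ∷ X)) (g (false ∷ X)))
      + ∑ˢ (λ X → when? ((c ∷ Y) ≟ˢ (true ∷ X)) (g (true ∷ X)))
      ≡⟨ cong₂ _+_ (∑ˢ-cong (λ X → when?-∷ c Y false X _)) (∑ˢ-cong (λ X → when?-∷ c Y true X _)) ⟩
    ∑ˢ (λ X → when? (Y ≟ˢ X) (when? (c Bool.≟ false) (g (false ∷ X))))
      + ∑ˢ (λ X → when? (Y ≟ˢ X) (when? (c Bool.≟ true) (g (true ∷ X))))
      ≡⟨ cong₂ _+_ (∑ˢ-point Y _) (∑ˢ-point Y _) ⟩
    when? (c Bool.≟ false) (g (false ∷ Y)) + when? (c Bool.≟ true) (g (true ∷ Y))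
      ≡⟨ by-bit c ⟩
    g (c ∷ Y) ∎
    where
    open ≡-Reasoning
    by-bit : ∀ c → when? (c Bool.≟ false) (g (false ∷ Y)) + when? (c Bool.≟ true) (g (true ∷ Y)) ≡ g (c ∷ Y)
    by-bit false = +-identityʳ _
    by-bit true  = refl

  ∑-∑ˢ-comm : ∀ a n (h : ℕ → Subset p → ℕ) → ∑ a n (λ k → ∑ˢ (h k)) ≡ ∑ˢ (λ X → ∑ a n (λ k → h k X))
  ∑-∑ˢ-comm {zero}  a n h = refl
  ∑-∑ˢ-comm {suc p} a n h = trans (∑-distrib-+ a n _ _)
    (cong₂ _+_ (∑-∑ˢ-comm a n (λ k X → h k (false ∷ X))) (∑-∑ˢ-comm a n (λ k X → h k (true ∷ X))))

  ∑ˢ-∣ : ∀ {N} (g : Subset p → ℕ) → (∀ X → N ∣ g X) → N ∣ ∑ˢ g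
  ∑ˢ-∣ {zero}  g dv = dv []
  ∑ˢ-∣ {suc p} g dv = ∣m∣n⇒∣m+n (∑ˢ-∣ _ (λ X → dv (false ∷ X))) (∑ˢ-∣ _ (λ X → dv (true ∷ X)))

module BlockArithmetic where

  open import Data.Bool using (Bool; true; false)
  open import Data.Empty using (⊥-elim)
  open import Data.Nat
  open import Data.Nat.DivMod
  open import Data.Nat.Divisibility using (_∣_; divides)
  open import Data.Nat.Properties
  open import Algebra.Properties.CommutativeSemigroup +-commutativeSemigroup using (x∙yz≈y∙xz; interchange)
  open import Data.Product using (_×_; _,_; proj₁; proj₂)
  open import Data.Sum using (_⊎_; inj₁; inj₂)
  open import Relation.Binary.PropositionalEquality
  open Sums using (when)

  -- b records whether the padding edge of the block was chosen
  rounding-bounds : ∀ N s W pad (b : Bool) → pad < N → (pad ≡ 0 → b ≡ false) →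
                    N * s + when b N ≡ W + pad → W < N * s + N × N * s < W + N
  rounding-bounds N s W pad false pad<N _ eq =
    ≤-<-trans (subst (W ≤_) (sym Ns≡) (m≤m+n W pad)) (m<m+n (N * s) (≤-<-trans z≤n pad<N)) ,
    subst (_< W + N) (sym Ns≡) (+-monoʳ-< W pad<N)
    where
    Ns≡ : N * s ≡ W + pad
    Ns≡ = trans (sym (+-identityʳ (N * s))) eq
  rounding-bounds N s W zero    true _     unpadded eq with () ← unpadded refl
  rounding-bounds N s W (suc pad) true pad<N _   eq =
    subst (W <_) (sym eq) (m<m+n W z<s) ,
    <-≤-trans (+-cancelʳ-< N (N * s) W (subst (_< W + N) (sym eq) (+-monoʳ-< W pad<N))) (m≤m+n W N)

  -- the deficit W = l r - σ of a block is at most the number N of elements still to come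
  disjoint-choice : ∀ {N p lr D W σ s} → N + p ≡ lr + D → W + σ ≡ lr → p ≤ σ + D →
                    W < N * s + N → N * s < W + N → (s ≡ 0 × p < σ + D) ⊎ s ≡ 1
  disjoint-choice {N} {p} {lr} {D} {W} {σ} {s} N+p≡ W+σ≡ p≤ W< Ns< with s
  ... | 0 = inj₁ (refl , +-cancelˡ-< N p (σ + D) (begin-strict
    N + p         ≡⟨ N+p≡ ⟩
    lr + D        ≡⟨ cong (_+ D) W+σ≡ ⟨
    W + σ + D     <⟨ +-monoˡ-< D (+-monoˡ-< σ (subst (W <_) (cong (_+ N) (*-zeroʳ N)) W<)) ⟩
    N + σ + D     ≡⟨ +-assoc N σ D ⟩
    N + (σ + D)   ∎))
    where open ≤-Reasoning
  ... | 1 = inj₂ refl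
  ... | 2+ t = ⊥-elim (<-irrefl refl (begin-strict
    N + N                ≤⟨ +-monoʳ-≤ N (m≤m+n N (N * t)) ⟩
    N + (N + N * t)      ≡⟨ cong (N +_) (*-suc N t) ⟨
    N + N * suc t        ≡⟨ *-suc N (suc t) ⟨
    N * 2+ t             <⟨ Ns< ⟩
    W + N                ≤⟨ +-monoˡ-≤ N W≤N ⟩
    N + N                ∎))
    where
    open ≤-Reasoning
    W≤N : W ≤ N
    W≤N = +-cancelʳ-≤ σ W N (+-cancelʳ-≤ D (W + σ) (N + σ) (begin
      W + σ + D      ≡⟨ cong (_+ D) W+σ≡ ⟩
      lr + D         ≡⟨ N+p≡ ⟨
      N + p          ≤⟨ +-monoʳ-≤ N p≤ ⟩
      N + (σ + D)    ≡⟨ +-assoc N σ D ⟨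
      N + σ + D      ∎))

  private
    deficit≥remaining : ∀ {N p m lr W σ} → m ≡ N + p → W + σ ≡ lr → σ + m ≤ p + lr → N ≤ W
    deficit≥remaining {N} {p} {m} {lr} {W} {σ} m≡ W+σ≡ σ+m≤ = +-cancelʳ-≤ (σ + p) N W (begin
      N + (σ + p)    ≡⟨ x∙yz≈y∙xz N σ p ⟩
      σ + (N + p)    ≡⟨ cong (σ +_) m≡ ⟨
      σ + m          ≤⟨ σ+m≤ ⟩
      p + lr         ≡⟨ cong (p +_) W+σ≡ ⟨
      p + (W + σ)    ≡⟨ x∙yz≈y∙xz p W σ ⟩
      W + (p + σ)    ≡⟨ cong (W +_) (+-comm p σ) ⟩
      W + (σ + p)    ∎)
      where open ≤-Reasoning

    covering-surplus : ∀ {N p m lr W σ s} → 0 < N → m ≡ N + p → W + σ ≡ lr → σ + m ≤ p + lr →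
                       W < N * s + N → N * s < W + N → 1 ≤ s × s + N ≤ suc W
    covering-surplus {N} {p} {m} {lr} {W} {σ} {s} 0<N m≡ W+σ≡ σ+m≤ W< Ns<
      with s | deficit≥remaining {N} {p} {m} {lr} {W} {σ} m≡ W+σ≡ σ+m≤
    ... | 0    | N≤W = ⊥-elim (<-irrefl refl (<-≤-trans (subst (W <_) (cong (_+ N) (*-zeroʳ N)) W<) N≤W))
    ... | 1    | N≤W = s≤s z≤n , s≤s N≤W
    ... | 2+ t | N≤W = s≤s z≤n , s≤s (begin
      suc t + N            ≡⟨ +-comm (suc t) N ⟩
      N + suc t            ≡⟨ +-suc N t ⟩
      suc (N + t)          ≤⟨ s≤s (+-monoʳ-≤ N (m≤n*m t N {{>-nonZero 0<N}})) ⟩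
      suc (N + N * t)      ≡⟨ cong suc (*-suc N t) ⟨
      suc (N * suc t)      ≤⟨ +-cancelʳ-< N (N * suc t) W (subst (_< W + N) (trans (*-suc N (suc t)) (+-comm N _)) Ns<) ⟩
      W                    ∎)
      where open ≤-Reasoning

  -- here the deficit W is at least N, so some slot is chosen, and the s - 1 further copies fit into W - N
  covering-choice : ∀ {N p m lr W σ s} → 0 < N → m ≡ N + p → W + σ ≡ lr → σ + m ≤ p + lr →
                    W < N * s + N → N * s < W + N → 1 ≤ s × s + σ + m ≤ suc p + lr
  covering-choice {N} {p} {m} {lr} {W} {σ} {s} 0<N m≡ W+σ≡ σ+m≤ W< Ns< =
    1≤s , (begin
      s + σ + m              ≡⟨ cong (s + σ +_) m≡ ⟩
      s + σ + (N + p)        ≡⟨ interchange s σ N p ⟩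
      s + N + (σ + p)        ≤⟨ +-monoˡ-≤ (σ + p) surplus ⟩
      suc W + (σ + p)        ≡⟨ cong suc (trans (sym (+-assoc W σ p)) (+-comm (W + σ) p)) ⟩
      suc p + (W + σ)        ≡⟨ cong (suc p +_) W+σ≡ ⟩
      suc p + lr             ∎)
    where
    open ≤-Reasoning
    1≤s = proj₁ (covering-surplus {N} {p} {m} {lr} {W} {σ} {s} 0<N m≡ W+σ≡ σ+m≤ W< Ns<)
    surplus = proj₂ (covering-surplus {N} {p} {m} {lr} {W} {σ} {s} 0<N m≡ W+σ≡ σ+m≤ W< Ns<)

  +pad-∣ : ∀ N .{{_ : NonZero N}} x → N ∣ x + (N ∸ x % N) % N
  +pad-∣ N x with x % N in x%N
  ... | zero  = divides (x / N) (begin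
    x + N % N          ≡⟨ cong (x +_) (n%n≡0 N) ⟩
    x + 0              ≡⟨ +-identityʳ x ⟩
    x                  ≡⟨ m≡m%n+[m/n]*n x N ⟩
    x % N + x / N * N  ≡⟨ cong (_+ x / N * N) x%N ⟩
    x / N * N          ∎)
    where open ≡-Reasoning
  ... | suc ρ = divides (suc (x / N)) (begin
    x + (N ∸ suc ρ) % N                    ≡⟨ cong (x +_) (m<n⇒m%n≡m (∸-monoʳ-< z<s (<⇒≤ ρ<N))) ⟩
    x + (N ∸ suc ρ)                        ≡⟨ cong (_+ (N ∸ suc ρ)) (trans (m≡m%n+[m/n]*n x N) (cong (_+ x / N * N) x%N)) ⟩
    suc ρ + x / N * N + (N ∸ suc ρ)        ≡⟨ cong (_+ (N ∸ suc ρ)) (+-comm (suc ρ) _) ⟩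
    x / N * N + suc ρ + (N ∸ suc ρ)        ≡⟨ +-assoc (x / N * N) (suc ρ) _ ⟩
    x / N * N + (suc ρ + (N ∸ suc ρ))      ≡⟨ cong (x / N * N +_) (m+[n∸m]≡n (<⇒≤ ρ<N)) ⟩
    x / N * N + N                          ≡⟨ +-comm (x / N * N) N ⟩
    suc (x / N) * N                        ∎)
    where
    open ≡-Reasoning
    ρ<N : suc ρ < N
    ρ<N = subst (_< N) x%N (m%n<n x N)

module Rounding {Row Col : Set} (_≟ʳ_ : DecidableEquality Row) (_≟ᶜ_ : DecidableEquality Col)
                (E : ℕ) (row : ℕ → Row) (col : ℕ → Col) (N : ℕ) (N>0 : 0 < N) where

  open import Data.Bool using (Bool; true; false; not; if_then_else_)
  import Data.Bool as B
  open import Data.Bool.Properties using (not-involutive; not-injective; ¬-not)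
  open import Data.Empty using (⊥; ⊥-elim)
  open import Data.Fin using (toℕ; fromℕ<)
  open import Data.Fin.Properties using (pigeonhole; fromℕ<-injective)
  open import Data.Nat
  open import Data.Nat.Divisibility using (_∣_; divides)
  open import Data.Nat.Induction using (<-rec)
  open import Data.Nat.Properties
  open import Data.Product using (Σ; _×_; _,_; proj₁; proj₂)
  open import Data.Sum using (_⊎_; inj₁; inj₂)
  open import Data.Sum.Properties using (≡-dec)
  open import Function using (_∘_)
  open import Relation.Binary.PropositionalEquality
  open import Relation.Nullary using (Dec; yes; no; ¬_; ¬?; _×-dec_)
  open Sums
  open Search

  -- edge e < E joins row e to col e; a weight w e ≤ N stands for the fraction w e / N

  Vertex : Set
  Vertex = Row ⊎ Col

  _≟ᵛ_ : DecidableEquality Vertex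
  _≟ᵛ_ = ≡-dec _≟ʳ_ _≟ᶜ_

  end : ℕ → Bool → Vertex
  end e true  = inj₁ (row e)
  end e false = inj₂ (col e)

  side : Vertex → Bool
  side (inj₁ _) = true
  side (inj₂ _) = false

  side-end : ∀ e s → side (end e s) ≡ s
  side-end e true  = refl
  side-end e false = refl

  load : (ℕ → ℕ) → Vertex → ℕ
  load w v = ∑ 0 E (λ e → when? (end e (side v) ≟ᵛ v) (w e))

  when?-refl : ∀ u x → when? (u ≟ᵛ u) x ≡ x
  when?-refl u x with u ≟ᵛ u
  ... | yes _   = refl
  ... | no  u≢u = ⊥-elim (u≢u refl)

  load-term : ∀ (w : ℕ → ℕ) e s → when? (end e (side (end e s)) ≟ᵛ end e s) (w e) ≡ w e
  load-term w e s rewrite side-end e s = when?-refl (end e s) (w e)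

  load-cong : ∀ {f g : ℕ → ℕ} v → (∀ e → f e ≡ g e) → load f v ≡ load g v
  load-cong v eq = ∑-cong′ 0 E (λ e → cong (when? (end e (side v) ≟ᵛ v)) (eq e))

  load-row : ∀ w x → load w (inj₁ x) ≡ ∑ 0 E (λ e → when? (row e ≟ʳ x) (w e))
  load-row w x = ∑-cong′ 0 E pointwise
    where
    pointwise : ∀ e → when? (inj₁ (row e) ≟ᵛ inj₁ x) (w e) ≡ when? (row e ≟ʳ x) (w e)
    pointwise e with row e ≟ʳ x
    ... | yes _ = refl
    ... | no  _ = refl

  load-col : ∀ w y → load w (inj₂ y) ≡ ∑ 0 E (λ e → when? (col e ≟ᶜ y) (w e))
  load-col w y = ∑-cong′ 0 E pointwise
    where
    pointwise : ∀ e → when? (inj₂ (col e) ≟ᵛ inj₂ y) (w e) ≡ when? (col e ≟ᶜ y) (w e)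
    pointwise e with col e ≟ᶜ y
    ... | yes _ = refl
    ... | no  _ = refl

  load-linear : ∀ (f g : ℕ → ℕ) c v → load (λ e → f e + c * g e) v ≡ load f v + c * load g v
  load-linear f g c v = trans (∑-cong′ 0 E split) (trans (∑-distrib-+ 0 E _ _) (cong (load f v +_) (∑-*ˡ 0 E c _)))
    where
    split : ∀ e → when? (end e (side v) ≟ᵛ v) (f e + c * g e) ≡
                  when? (end e (side v) ≟ᵛ v) (f e) + c * when? (end e (side v) ≟ᵛ v) (g e)
    split e with end e (side v) ≟ᵛ v
    ... | yes _ = refl
    ... | no  _ = sym (*-zeroʳ c)

  at-row : ∀ e s x → when? (end e true ≟ᵛ inj₁ x) (when s 1) ≡ when? (end e s ≟ᵛ inj₁ x) 1
  at-row e true  x = refl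
  at-row e false x = when?-zero (end e true ≟ᵛ inj₁ x)

  at-col : ∀ e s y → when? (end e false ≟ᵛ inj₂ y) (when s 1) ≡ when? (end e (not s) ≟ᵛ inj₂ y) 1
  at-col e true  y = refl
  at-col e false y = when?-zero (end e false ≟ᵛ inj₂ y)

  Fractional : ℕ → Set
  Fractional x = 0 < x × x < N

  fractional? : ∀ x → Dec (Fractional x)
  fractional? x = 0 <? x ×-dec x <? N

  fractional-∤ : ∀ {x} → Fractional x → ¬ N ∣ x
  fractional-∤ (0<x , x<N) (divides zero    refl) = <-irrefl refl 0<x
  fractional-∤ (0<x , x<N) (divides (suc q) refl) = <-irrefl refl (<-≤-trans x<N (m≤m+n N (q * N)))

  integral-cases : ∀ {x} → x ≤ N → ¬ Fractional x → x ≡ 0 ⊎ x ≡ N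
  integral-cases {zero}  _   _        = inj₁ refl
  integral-cases {suc x} x≤N integral with m≤n⇒m<n∨m≡n x≤N
  ... | inj₁ x<N = ⊥-elim (integral (z<s , x<N))
  ... | inj₂ x≡N = inj₂ x≡N

  integral-∣ : ∀ {x} → x ≤ N → ¬ Fractional x → N ∣ x
  integral-∣ x≤N integral with integral-cases x≤N integral
  ... | inj₁ refl = divides 0 refl
  ... | inj₂ refl = divides 1 (sym (+-identityʳ N))

  record Balanced (w : ℕ → ℕ) : Set where
    field
      bounded   : ∀ e → w e ≤ N
      divisible : ∀ v → N ∣ load w v

  fractionalEdges : (ℕ → ℕ) → ℕ
  fractionalEdges w = ∑ 0 E (λ e → when? (fractional? (w e)) 1)

  -- the load at an end of e is a multiple of N, and so are the integral weights there
  fractional-branch : ∀ {w} → Balanced w → ∀ e s → e < E → Fractional (w e) →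
                      Σ ℕ λ e′ → e′ < E × Fractional (w e′) × e′ ≢ e × end e′ s ≡ end e s
  fractional-branch {w} bal e s e<E frac
    with anyUpTo? (λ e′ → (fractional? (w e′) ×-dec ¬? (e′ ≟ e)) ×-dec (end e′ s ≟ᵛ end e s)) E
  ... | yes (e′ , e′<E , (frac′ , e′≢e) , shared) = e′ , e′<E , frac′ , e′≢e , shared
  ... | no none = ⊥-elim (fractional-∤ frac (subst (N ∣_) (load-term w e s)
         (∑-∣-remaining 0 E e z≤n e<E (Balanced.divisible bal (end e s)) others)))
    where
    others : ∀ k → 0 ≤ k → k < 0 + E → k ≢ e → N ∣ when? (end k (side (end e s)) ≟ᵛ end e s) (w k)
    others k _ k<E k≢e rewrite side-end e s with end k s ≟ᵛ end e s
    ... | no  _      = divides 0 refl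
    ... | yes shared = integral-∣ (Balanced.bounded bal k) (λ frac′ → none (k , k<E , (frac′ , k≢e) , shared))

  -- Walking along fractional edges, alternately through row and column ends, eventually revisits a
  -- vertex; the first revisit closes an even cycle of distinct edges. Raising and lowering its edges
  -- alternately by the least slack δ keeps every load and makes some edge integral.
  module Cancellation {w : ℕ → ℕ} (bal : Balanced w) (e₀ : ℕ) (e₀<E : e₀ < E) (frac₀ : Fractional (w e₀)) where
    open Balanced bal

    record Position : Set where
      constructor ⟨_,_,_,_⟩
      field
        edge       : ℕ
        exit       : Bool
        edge<E     : edge < E
        fractional : Fractional (w edge)

    open Position

    next : Position → Position
    next ⟨ e , s , e<E , frac ⟩ with fractional-branch bal e s e<E frac
    ... | e′ , e′<E , frac′ , _ , _ = ⟨ e′ , not s , e′<E , frac′ ⟩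

    next-spec : ∀ p → edge (next p) ≢ edge p × exit (next p) ≡ not (exit p)
                    × end (edge (next p)) (exit p) ≡ end (edge p) (exit p)
    next-spec ⟨ e , s , e<E , frac ⟩ with fractional-branch bal e s e<E frac
    ... | e′ , e′<E , frac′ , e′≢e , shared = e′≢e , refl , shared

    walk : ℕ → Position
    walk zero    = ⟨ e₀ , true , e₀<E , frac₀ ⟩
    walk (suc k) = next (walk k)

    edgeAt : ℕ → ℕ
    edgeAt k = edge (walk k)

    exitAt : ℕ → Bool
    exitAt k = exit (walk k)

    -- the vertex shared by the k-th and (k+1)-st edges of the walk
    vertexAt : ℕ → Vertex
    vertexAt k = end (edgeAt k) (exitAt k)

    entry : ∀ k → end (edgeAt (suc k)) (not (exitAt (suc k))) ≡ vertexAt k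
    entry k with next-spec (walk k)
    ... | _ , flip , shared rewrite flip | not-involutive (exitAt k) = shared

    double : ℕ → ℕ
    double zero    = zero
    double (suc t) = suc (suc (double t))

    exit-double : ∀ t → exitAt (double t) ≡ true
    exit-double zero    = refl
    exit-double (suc t) rewrite proj₁ (proj₂ (next-spec (walk (suc (double t)))))
                              | proj₁ (proj₂ (next-spec (walk (double t)))) =
      trans (not-involutive _) (exit-double t)

    Repeat : ℕ → Set
    Repeat y = Σ ℕ λ x → x < y × vertexAt x ≡ vertexAt y

    repeat? : ∀ y → Dec (Repeat y)
    repeat? y with anyUpTo? (λ x → vertexAt x ≟ᵛ vertexAt y) y
    ... | yes (x , x<y , eq) = yes (x , x<y , eq)
    ... | no  none           = no λ (x , x<y , eq) → none (x , x<y , eq)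

    -- among the E + 1 vertices visited at even steps, all rows, two coincide
    some-repeat : Σ ℕ Repeat
    some-repeat with pigeonhole (n<1+n E) (λ t → fromℕ< (edge<E (walk (double (toℕ t)))))
    ... | t , t′ , t<t′ , same = double (toℕ t′) , double (toℕ t) , double-mono t<t′ ,
      cong₂ end (fromℕ<-injective _ _ (edge<E (walk (double (toℕ t)))) (edge<E (walk (double (toℕ t′)))) same)
                (trans (exit-double (toℕ t)) (sym (exit-double (toℕ t′))))
      where
      double-mono : ∀ {a b} → a < b → double a < double b
      double-mono {zero}  {suc b} _       = z<s
      double-mono {suc a} {suc b} (s≤s a<b) = s≤s (s≤s (double-mono a<b))

    edge-next : ∀ k → edgeAt (suc k) ≢ edgeAt k
    edge-next k = proj₁ (next-spec (walk k))

    -- abstract: unfolding the search for the cycle makes checking the rest of the module very slow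
    abstract
      first-repeat : Σ ℕ λ j → Repeat j × (∀ y → y < j → ¬ Repeat y)
      first-repeat = least repeat? (proj₂ some-repeat)

      j : ℕ
      j = proj₁ first-repeat

      i : ℕ
      i = proj₁ (proj₁ (proj₂ first-repeat))

      i<j : i < j
      i<j = proj₁ (proj₂ (proj₁ (proj₂ first-repeat)))

      closed : vertexAt i ≡ vertexAt j
      closed = proj₂ (proj₂ (proj₁ (proj₂ first-repeat)))

      no-earlier : ∀ y → y < j → ¬ Repeat y
      no-earlier = proj₂ (proj₂ first-repeat)

    simple : ∀ x y → i ≤ x → x < y → y ≤ j → vertexAt x ≡ vertexAt y → x ≡ i × y ≡ j
    simple x y i≤x x<y y≤j same with m≤n⇒m<n∨m≡n y≤j
    ... | inj₁ y<j  = ⊥-elim (no-earlier y y<j (x , x<y , same))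
    ... | inj₂ refl with m≤n⇒m<n∨m≡n i≤x
    ...   | inj₁ i<x  = ⊥-elim (no-earlier x x<y (i , i<x , trans closed (sym same)))
    ...   | inj₂ refl = refl , refl

    distinct-edges : ∀ k k′ → suc i ≤ k → k < k′ → k′ ≤ j → edgeAt k ≢ edgeAt k′
    distinct-edges (suc p) (suc p′) (s≤s i≤p) k<k′ k′≤j same with exitAt (suc p) B.≟ exitAt (suc p′)
    ... | yes exits =
      <⇒≢ (s≤s i≤p) (sym (proj₁ (simple (suc p) (suc p′) (m≤n⇒m≤1+n i≤p) k<k′ k′≤j (cong₂ end same exits))))
    ... | no  exits = reversed (m≤n⇒m<n∨m≡n (≤-pred k<k′))
      where
      flipped : exitAt (suc p′) ≡ not (exitAt (suc p))
      flipped = ¬-not (exits ∘ sym)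
      -- the repeated edge would be traversed in the opposite direction, closing the cycle early
      p′-at-start : vertexAt p′ ≡ vertexAt (suc p)
      p′-at-start = trans (sym (entry p′)) (cong₂ end (sym same)
        (trans (cong not flipped) (not-involutive _)))
      reversed : suc p < p′ ⊎ suc p ≡ p′ → ⊥
      reversed (inj₁ k<p′) = <⇒≢ (s≤s i≤p)
        (sym (proj₁ (simple (suc p) p′ (m≤n⇒m≤1+n i≤p) k<p′ (≤-trans (n≤1+n p′) k′≤j) (sym p′-at-start))))
      reversed (inj₂ refl) = edge-next (suc p) (sym same)

    L : ℕ
    L = j ∸ suc i

    -- the cycle consists of the steps suc i , … , j of the walk
    len : ℕ
    len = suc L

    i+len≡j : i + len ≡ j
    i+len≡j = trans (+-suc i L) (m+[n∸m]≡n i<j)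

    ≤j : ∀ {k} → k < suc i + len → k ≤ j
    ≤j {k} k< = ≤-pred (subst (k <_) (cong suc i+len≡j) k<)

    up : ℕ → ℕ
    up e = ∑ (suc i) len (λ k → when? (e ≟ edgeAt k) (when (not (exitAt k)) 1))

    down : ℕ → ℕ
    down e = ∑ (suc i) len (λ k → when? (e ≟ edgeAt k) (when (exitAt k) 1))

    up+down≤1 : ∀ e → up e + down e ≤ 1
    up+down≤1 e = subst (_≤ 1) (trans (∑-cong′ (suc i) len split) (∑-distrib-+ (suc i) len
        (λ k → when? (e ≟ edgeAt k) (when (not (exitAt k)) 1)) (λ k → when? (e ≟ edgeAt k) (when (exitAt k) 1))))
      (∑-≤1 (suc i) len _ (λ k → when?≤ (e ≟ edgeAt k) 1) once)
      where
      split : ∀ k → when? (e ≟ edgeAt k) 1 ≡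
                    when? (e ≟ edgeAt k) (when (not (exitAt k)) 1) + when? (e ≟ edgeAt k) (when (exitAt k) 1)
      split k with e ≟ edgeAt k | exitAt k
      ... | yes _ | true  = refl
      ... | yes _ | false = refl
      ... | no  _ | _     = refl
      hit : ∀ {k} → when? (e ≟ edgeAt k) 1 ≡ 1 → e ≡ edgeAt k
      hit {k} eq with e ≟ edgeAt k
      ... | yes e≡ = e≡
      ... | no  _  = ⊥-elim (0≢1+n eq)
      once : ∀ k k′ → suc i ≤ k → k < k′ → k′ < suc i + len →
             when? (e ≟ edgeAt k) 1 ≡ 1 → when? (e ≟ edgeAt k′) 1 ≡ 1 → ⊥
      once k k′ i<k k<k′ k′< hk hk′ =
        distinct-edges k k′ i<k k<k′ (≤j k′<) (trans (sym (hit {k} hk)) (hit {k′} hk′))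

    slack-if : ℕ → Bool → ℕ
    slack-if k b = if b then w (edgeAt k) else N ∸ w (edgeAt k)

    slack : ℕ → ℕ
    slack k = slack-if k (exitAt k)

    abstract
      k* : ℕ
      k* = proj₁ (minimizer (suc i) L slack)

      i<k* : suc i ≤ k*
      i<k* = proj₁ (proj₂ (minimizer (suc i) L slack))

      k*< : k* < suc i + len
      k*< = proj₁ (proj₂ (proj₂ (minimizer (suc i) L slack)))

      k*-tightest : ∀ k → suc i ≤ k → k < suc i + len → slack k* ≤ slack k
      k*-tightest = proj₂ (proj₂ (proj₂ (minimizer (suc i) L slack)))

    δ : ℕ
    δ = slack k*

    traversal : ∀ e (s : ℕ → Bool) → 0 < ∑ (suc i) len (λ k → when? (e ≟ edgeAt k) (when (s k) 1)) →
                Σ ℕ λ k → suc i ≤ k × k < suc i + len × e ≡ edgeAt k × s k ≡ true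
    traversal e s pos with ∑-pos (suc i) len _ pos
    ... | k , i<k , k< , hit with e ≟ edgeAt k | s k in sk
    ...   | yes e≡ | true  = k , i<k , k< , e≡ , sk
    ...   | yes _  | false = ⊥-elim (<-irrefl refl hit)
    ...   | no  _  | _     = ⊥-elim (<-irrefl refl hit)

    too-many : ∀ {e a b} → up e ≡ a → down e ≡ b → 1 < a + b → ⊥
    too-many {e} refl refl = ≤⇒≯ (up+down≤1 e)

    data Change (e : ℕ) : Set where
      unchanged : up e ≡ 0 → down e ≡ 0 → Change e
      raised    : up e ≡ 1 → down e ≡ 0 → δ ≤ N ∸ w e → Fractional (w e) → Change e
      lowered   : up e ≡ 0 → down e ≡ 1 → δ ≤ w e → Fractional (w e) → Change e

    change : ∀ e → Change e
    change e with up e in u | down e in d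
    ... | 0    | 0    = unchanged u d
    ... | 1    | 0    with traversal e (not ∘ exitAt) (subst (0 <_) (sym u) z<s)
    ...   | k , i<k , k< , e≡ , leaves-col = raised u d
      (subst (δ ≤_) (trans (cong (slack-if k) (not-injective leaves-col)) (cong (λ x → N ∸ w x) (sym e≡)))
        (k*-tightest k i<k k<))
      (subst (Fractional ∘ w) (sym e≡) (fractional (walk k)))
    change e | 0    | 1    with traversal e exitAt (subst (0 <_) (sym d) z<s)
    ...   | k , i<k , k< , e≡ , leaves-row = lowered u d
      (subst (δ ≤_) (trans (cong (slack-if k) leaves-row) (cong w (sym e≡))) (k*-tightest k i<k k<))
      (subst (Fractional ∘ w) (sym e≡) (fractional (walk k)))
    change e | 0    | 2+ _ = ⊥-elim (too-many u d (s≤s (s≤s z≤n)))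
    change e | 1    | suc _ = ⊥-elim (too-many u d (s≤s (s≤s z≤n)))
    change e | 2+ _ | _    = ⊥-elim (too-many u d (s≤s (s≤s z≤n)))

    down-covered : ∀ e → δ * down e ≤ w e + δ * up e
    down-covered e with change e
    ... | unchanged _ d     = subst (_≤ w e + δ * up e) (sym (trans (cong (δ *_) d) (*-zeroʳ δ))) z≤n
    ... | raised _ d _ _    = subst (_≤ w e + δ * up e) (sym (trans (cong (δ *_) d) (*-zeroʳ δ))) z≤n
    ... | lowered _ d δ≤w _ =
      ≤-trans (≤-reflexive (trans (cong (δ *_) d) (*-identityʳ δ))) (≤-trans δ≤w (m≤m+n (w e) _))

    abstract
      w′ : ℕ → ℕ
      w′ e = w e + δ * up e ∸ δ * down e

      w′-changes : ∀ e {a b} → up e ≡ a → down e ≡ b → w′ e ≡ w e + δ * a ∸ δ * b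
      w′-changes e u d = cong₂ (λ a b → w e + δ * a ∸ δ * b) u d

      w′-balance : ∀ e → w′ e + δ * down e ≡ w e + δ * up e
      w′-balance e = m∸n+n≡m (down-covered e)

    w′-unchanged : ∀ e → up e ≡ 0 → down e ≡ 0 → w′ e ≡ w e
    w′-unchanged e u d = trans (w′-changes e u d)
      (trans (cong₂ (λ a b → w e + a ∸ b) (*-zeroʳ δ) (*-zeroʳ δ)) (+-identityʳ (w e)))

    w′-raised : ∀ e → up e ≡ 1 → down e ≡ 0 → w′ e ≡ w e + δ
    w′-raised e u d = trans (w′-changes e u d) (cong₂ (λ a b → w e + a ∸ b) (*-identityʳ δ) (*-zeroʳ δ))

    w′-lowered : ∀ e → up e ≡ 0 → down e ≡ 1 → w′ e ≡ w e ∸ δ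
    w′-lowered e u d = trans (w′-changes e u d)
      (cong₂ _∸_ (trans (cong (w e +_) (*-zeroʳ δ)) (+-identityʳ (w e))) (*-identityʳ δ))

    w′-bounded : ∀ e → w′ e ≤ N
    w′-bounded e with change e
    ... | unchanged u d rewrite w′-unchanged e u d = bounded e
    ... | raised u d δ≤ _ rewrite w′-raised e u d = subst (w e + δ ≤_) (m+[n∸m]≡n (bounded e)) (+-monoʳ-≤ (w e) δ≤)
    ... | lowered u d _ _ rewrite w′-lowered e u d = ≤-trans (m∸n≤m (w e) δ) (bounded e)

    w′-integral : ∀ e → ¬ Fractional (w e) → w′ e ≡ w e
    w′-integral e integral with change e
    ... | unchanged u d   = w′-unchanged e u d
    ... | raised _ _ _ frac  = ⊥-elim (integral frac)
    ... | lowered _ _ _ frac = ⊥-elim (integral frac)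

    exits : Vertex → ℕ
    exits v = ∑ (suc i) len (λ k → when? (vertexAt k ≟ᵛ v) 1)

    entries : Vertex → ℕ
    entries v = ∑ (suc i) len (λ k → when? (end (edgeAt k) (not (exitAt k)) ≟ᵛ v) 1)

    entries≡exits : ∀ v → entries v ≡ exits v
    entries≡exits v = begin
      entries v                                    ≡⟨ ∑-shift i len _ ⟩
      ∑ i len (λ k → when? (end (edgeAt (suc k)) (not (exitAt (suc k))) ≟ᵛ v) 1)
                                                   ≡⟨ ∑-cong′ i len (λ k → cong (λ u → when? (u ≟ᵛ v) 1) (entry k)) ⟩
      ∑ i len (λ k → when? (vertexAt k ≟ᵛ v) 1)    ≡⟨ ∑-rotate i len _ (cong (λ u → when? (u ≟ᵛ v) 1) closed′) ⟩
      exits v                                      ∎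
      where
      open ≡-Reasoning
      closed′ : vertexAt i ≡ vertexAt (i + len)
      closed′ = trans closed (cong vertexAt (sym i+len≡j))

    load-by-steps : ∀ (s : ℕ → Bool) v →
      load (λ e → ∑ (suc i) len (λ k → when? (e ≟ edgeAt k) (when (s k) 1))) v ≡
      ∑ (suc i) len (λ k → when? (end (edgeAt k) (side v) ≟ᵛ v) (when (s k) 1))
    load-by-steps s v = ∑-fibres (λ e → end e (side v) ≟ᵛ v) E (suc i) len edgeAt (λ k → when (s k) 1)
                                 (λ k _ _ → edge<E (walk k))

    -- each vertex of the cycle is left once and entered once, through edges of opposite change
    load-down≡load-up : ∀ v → load down v ≡ load up v
    load-down≡load-up v@(inj₁ x) = begin
      load down v     ≡⟨ load-by-steps exitAt v ⟩
      _               ≡⟨ ∑-cong′ (suc i) len (λ k → at-row (edgeAt k) (exitAt k) x) ⟩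
      exits v         ≡⟨ entries≡exits v ⟨
      entries v       ≡⟨ ∑-cong′ (suc i) len (λ k → at-row (edgeAt k) (not (exitAt k)) x) ⟨
      _               ≡⟨ load-by-steps (not ∘ exitAt) v ⟨
      load up v       ∎
      where open ≡-Reasoning
    load-down≡load-up v@(inj₂ y) = begin
      load down v     ≡⟨ load-by-steps exitAt v ⟩
      _               ≡⟨ ∑-cong′ (suc i) len (λ k → at-col (edgeAt k) (exitAt k) y) ⟩
      entries v       ≡⟨ entries≡exits v ⟩
      exits v         ≡⟨ ∑-cong′ (suc i) len (λ k → cong (λ s → when? (end (edgeAt k) s ≟ᵛ v) 1)
                                                      (not-involutive (exitAt k))) ⟨
      _               ≡⟨ ∑-cong′ (suc i) len (λ k → at-col (edgeAt k) (not (exitAt k)) y) ⟨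
      _               ≡⟨ load-by-steps (not ∘ exitAt) v ⟨
      load up v       ∎
      where open ≡-Reasoning

    load-preserved : ∀ v → load w′ v ≡ load w v
    load-preserved v = +-cancelʳ-≡ _ (load w′ v) (load w v) (begin
      load w′ v + δ * load down v                  ≡⟨ load-linear w′ down δ v ⟨
      load (λ e → w′ e + δ * down e) v             ≡⟨ load-cong v w′-balance ⟩
      load (λ e → w e + δ * up e) v                ≡⟨ load-linear w up δ v ⟩
      load w v + δ * load up v                     ≡⟨ cong (λ x → load w v + δ * x) (load-down≡load-up v) ⟨
      load w v + δ * load down v                   ∎)
      where open ≡-Reasoning

    balanced′ : Balanced w′
    balanced′ = record
      { bounded   = w′-bounded
      ; divisible = λ v → subst (N ∣_) (sym (load-preserved v)) (divisible v)
      }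

    traversed-at : ∀ k → suc i ≤ k → k < suc i + len → ∀ (s : ℕ → Bool) → s k ≡ true →
                   1 ≤ ∑ (suc i) len (λ k′ → when? (edgeAt k ≟ edgeAt k′) (when (s k′) 1))
    traversed-at k i<k k< s sk = subst (_≤ ∑ (suc i) len f)
      (trans (cong (when? (edgeAt k ≟ edgeAt k)) (cong (λ b → when b 1) sk)) (when?-yes refl (edgeAt k ≟ edgeAt k) 1))
      (term≤∑ {f} (suc i) len k i<k k<)
      where
      f = λ k′ → when? (edgeAt k ≟ edgeAt k′) (when (s k′) 1)

    not-down : down (edgeAt k*) ≡ 0 → exitAt k* ≡ true → ⊥
    not-down d leaves = 0≢1+n (sym (n≤0⇒n≡0 (subst (1 ≤_) d (traversed-at k* i<k* k*< exitAt leaves))))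

    not-up : up (edgeAt k*) ≡ 0 → exitAt k* ≡ false → ⊥
    not-up u leaves = 0≢1+n (sym (n≤0⇒n≡0 (subst (1 ≤_) u (traversed-at k* i<k* k*< (not ∘ exitAt) (cong not leaves)))))

    tightest-integral : ¬ Fractional (w′ (edgeAt k*))
    tightest-integral = by-exit (exitAt k*) refl (change (edgeAt k*))
      where
      e* = edgeAt k*
      by-exit : ∀ b → exitAt k* ≡ b → Change e* → ¬ Fractional (w′ e*)
      by-exit true  leaves (unchanged _ d)   _ = not-down d leaves
      by-exit true  leaves (raised _ d _ _)  _ = not-down d leaves
      by-exit false leaves (unchanged u _)   _ = not-up u leaves
      by-exit false leaves (lowered u _ _ _) _ = not-up u leaves
      by-exit true  leaves (lowered u d _ _) (0<w′ , _) = <-irrefl (sym emptied) 0<w′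
        where
        emptied : w′ e* ≡ 0
        emptied = trans (w′-lowered e* u d) (trans (cong (w e* ∸_) (cong (slack-if k*) leaves)) (n∸n≡0 (w e*)))
      by-exit false leaves (raised u d _ _)  (_ , w′<N) = <-irrefl filled w′<N
        where
        filled : w′ e* ≡ N
        filled = trans (w′-raised e* u d) (trans (cong (w e* +_) (cong (slack-if k*) leaves)) (m+[n∸m]≡n (bounded e*)))

    fewer-fractional : fractionalEdges w′ < fractionalEdges w
    fewer-fractional = ∑-mono-< 0 E indicator-mono (edgeAt k*) z≤n (edge<E (walk k*)) strict
      where
      indicator-mono : ∀ e → when? (fractional? (w′ e)) 1 ≤ when? (fractional? (w e)) 1
      indicator-mono e with fractional? (w e)
      ... | yes _        = when?≤ (fractional? (w′ e)) 1
      ... | no  integral = ≤-reflexive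
        (when?-no (subst (λ x → ¬ Fractional x) (sym (w′-integral e integral)) integral) (fractional? (w′ e)) 1)
      strict : when? (fractional? (w′ (edgeAt k*))) 1 < when? (fractional? (w (edgeAt k*))) 1
      strict = subst₂ _<_ (sym (when?-no tightest-integral (fractional? _) 1))
                          (sym (when?-yes (fractional (walk k*)) (fractional? _) 1)) z<s

  scaled : (ℕ → Bool) → ℕ → ℕ
  scaled sel e = when (sel e) N

  Rounds : (ℕ → ℕ) → (ℕ → Bool) → Set
  Rounds w sel = (∀ v → load (scaled sel) v ≡ load w v) × (∀ e → w e ≡ 0 → sel e ≡ false)

  integral-rounding : ∀ {w} → Balanced w → fractionalEdges w ≡ 0 → Rounds w (λ e → 0 <ᵇ w e)
  integral-rounding {w} bal none = same-load , λ e w≡0 → cong (0 <ᵇ_) w≡0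
    where
    open Balanced bal
    integral : ∀ e → e < E → ¬ Fractional (w e)
    integral e e<E frac = 0≢1+n (sym (n≤0⇒n≡0 (subst (1 ≤_) none
      (subst (_≤ fractionalEdges w) (when?-yes frac (fractional? (w e)) 1) (term≤∑ 0 E e z≤n e<E)))))
    exact : ∀ e → e < E → when (0 <ᵇ w e) N ≡ w e
    exact e e<E with integral-cases (bounded e) (integral e e<E)
    ... | inj₁ w≡0 rewrite w≡0 = refl
    ... | inj₂ w≡N rewrite w≡N = full N>0
      where
      full : ∀ {n} → 0 < n → when (0 <ᵇ n) n ≡ n
      full z<s = refl
    same-load : ∀ v → load (scaled (λ e → 0 <ᵇ w e)) v ≡ load w v
    same-load v = ∑-cong 0 E (λ e _ e<E → cong (when? (end e (side v) ≟ᵛ v)) (exact e e<E))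

  cancel-cycle : ∀ {w} → Balanced w → 0 < fractionalEdges w →
                 Σ (ℕ → ℕ) λ w′ → Balanced w′ × fractionalEdges w′ < fractionalEdges w
                                × (∀ v → load w′ v ≡ load w v) × (∀ e → w e ≡ 0 → w′ e ≡ 0)
  cancel-cycle {w} bal some with ∑-pos 0 E _ some
  ... | e₀ , _ , e₀<E , frac with fractional? (w e₀)
  ...   | no  _     = ⊥-elim (<-irrefl refl frac)
  ...   | yes frac₀ = w′ , balanced′ , fewer-fractional , load-preserved ,
                      λ e w≡0 → trans (w′-integral e λ (0<w , _) → <-irrefl (sym w≡0) 0<w) w≡0
    where open Cancellation bal e₀ e₀<E frac₀

  round : ∀ w → Balanced w → Σ (ℕ → Bool) (Rounds w)
  round w bal = <-rec Goal step (fractionalEdges w) w refl bal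
    where
    Goal : ℕ → Set
    Goal n = ∀ w → fractionalEdges w ≡ n → Balanced w → Σ (ℕ → Bool) (Rounds w)
    step : ∀ n → (∀ {n′} → n′ < n → Goal n′) → Goal n
    step zero    _   w none bal = (λ e → 0 <ᵇ w e) , integral-rounding bal none
    step (suc n) rec w some bal with cancel-cycle bal (subst (0 <_) (sym some) z<s)
    ... | w′ , bal′ , fewer , loads′ , zeros′ with rec (subst (fractionalEdges w′ <_) some fewer) w′ refl bal′
    ...   | sel , loads , zeros = sel , (λ v → trans (loads v) (loads′ v)) , λ e w≡0 → zeros e (zeros′ e w≡0)

module Baranyai (m r l′ : ℕ) where

  open import Data.Bool using (Bool; true; false)
  import Data.Bool as Bool
  open import Data.Bool.ListAction using (or)
  open import Data.Empty using (⊥-elim)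
  open import Data.Fin.Subset using (Subset; ∣_∣; ⋃)
  open import Data.List using (applyUpTo)
  open import Data.Maybe using (Maybe; just; nothing)
  open import Data.Maybe.Properties using (≡-dec)
  open import Data.Nat
  open import Data.Nat.Combinatorics using (_C_; k>n⇒nCk≡0; nCk+nC[k+1]≡[n+1]C[k+1])
  open import Data.Nat.Divisibility using (_∣_; divides; ∣m+n∣m⇒∣n)
  open import Data.Nat.DivMod
  open import Data.Nat.Properties
  open import Data.Product using (Σ; _×_; _,_; proj₁; proj₂)
  open import Data.Sum using (inj₁; inj₂)
  open import Data.Vec using ([]; _∷_)
  open import Relation.Binary using (DecidableEquality)
  open import Relation.Binary.PropositionalEquality
  open import Relation.Nullary using (Dec; yes; no)
  open Sums
  open SubsetSums
  open Binomial
  open BlockArithmetic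

  l : ℕ
  l = suc l′

  T : ℕ
  T = m C r

  -- slot k < T belongs to block k / l; the blocks j < d are full
  d : ℕ
  d = T / l

  full-block≤T : ∀ j → j < d → j * l + l ≤ T
  full-block≤T j j<d = ≤-trans (≤-reflexive (+-comm (j * l) l)) (≤-trans (*-monoˡ-≤ l j<d) (m/n*n≤m T l))

  block≤d : ∀ k → k < T → k / l ≤ d
  block≤d k k<T = /-monoˡ-≤ l (<⇒≤ k<T)

  ∑-block : ∀ j → j < d → (h : ℕ → ℕ) → ∑ 0 T (λ k → when? (k / l ≟ j) (h k)) ≡ ∑ (j * l) l h
  ∑-block j j<d h = begin
    ∑ 0 T f                                                   ≡⟨ cong (λ n → ∑ 0 n f) T≡ ⟨
    ∑ 0 (j * l + (l + rest)) f                                ≡⟨ ∑-++ 0 (j * l) (l + rest) f ⟩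
    ∑ 0 (j * l) f + ∑ (j * l) (l + rest) f                    ≡⟨ cong (_+ ∑ (j * l) (l + rest) f) (∑-zero 0 (j * l) before) ⟩
    ∑ (j * l) (l + rest) f                                    ≡⟨ ∑-++ (j * l) l rest f ⟩
    ∑ (j * l) l f + ∑ (j * l + l) rest f                      ≡⟨ cong₂ _+_ (∑-cong (j * l) l inside) (∑-zero (j * l + l) rest after) ⟩
    ∑ (j * l) l h + 0                                         ≡⟨ +-identityʳ _ ⟩
    ∑ (j * l) l h                                             ∎
    where
    open ≡-Reasoning
    f = λ k → when? (k / l ≟ j) (h k)
    rest = T ∸ (j * l + l)
    T≡ : j * l + (l + rest) ≡ T
    T≡ = trans (sym (+-assoc (j * l) l rest)) (m+[n∸m]≡n (full-block≤T j j<d))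
    before : ∀ k → 0 ≤ k → k < 0 + j * l → f k ≡ 0
    before k _ k< with k / l ≟ j
    ... | yes k/l≡j = ⊥-elim (<-irrefl k/l≡j (m<n*o⇒m/o<n k<))
    ... | no  _     = refl
    inside : ∀ k → j * l ≤ k → k < j * l + l → f k ≡ h k
    inside k jl≤k k< with k / l ≟ j
    ... | yes _     = refl
    ... | no  k/l≢j = ⊥-elim (k/l≢j (≤-antisym (≤-pred (m<n*o⇒m/o<n (subst (k <_) (+-comm (j * l) l) k<)))
                                             (subst (_≤ k / l) (m*n/n≡m j l) (/-monoˡ-≤ l jl≤k))))
    after : ∀ k → j * l + l ≤ k → k < j * l + l + rest → f k ≡ 0
    after k jl+l≤k _ with k / l ≟ j
    ... | yes k/l≡j = ⊥-elim (<-irrefl (sym k/l≡j)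
            (subst (_≤ k / l) (m*n/n≡m (suc j) l) (/-monoˡ-≤ l (subst (_≤ k) (+-comm (j * l) l) jl+l≤k))))
    ... | no  _     = refl

  multiplicity : ∀ {p} → (ℕ → Subset p) → Subset p → ℕ
  multiplicity S X = ∑ 0 T (λ k → when? (S k ≟ˢ X) 1)

  ∑-of-type : ∀ {p} (S : ℕ → Subset p) X v → ∑ 0 T (λ k → when? (S k ≟ˢ X) v) ≡ multiplicity S X * v
  ∑-of-type S X v = trans (∑-cong′ 0 T (λ k → scale (S k ≟ˢ X))) (trans (∑-*ˡ 0 T v _) (*-comm v _))
    where
    scale : ∀ {P : Set} (d : Dec P) → when? d v ≡ v * when? d 1
    scale (yes _) = sym (*-identityʳ v)
    scale (no  _) = sym (*-zeroʳ v)

  slots-by-type : ∀ {p} (S : ℕ → Subset p) g → ∑ 0 T (λ k → g (S k)) ≡ ∑ˢ (λ X → multiplicity S X * g X)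
  slots-by-type S g = begin
    ∑ 0 T (λ k → g (S k))                                   ≡⟨ ∑-cong′ 0 T (λ k → ∑ˢ-point (S k) g) ⟨
    ∑ 0 T (λ k → ∑ˢ (λ X → when? (S k ≟ˢ X) (g X)))         ≡⟨ ∑-∑ˢ-comm 0 T (λ k X → when? (S k ≟ˢ X) (g X)) ⟩
    ∑ˢ (λ X → ∑ 0 T (λ k → when? (S k ≟ˢ X) (g X)))         ≡⟨ ∑ˢ-cong (λ X → ∑-of-type S X (g X)) ⟩
    ∑ˢ (λ X → multiplicity S X * g X)                       ∎
    where open ≡-Reasoning

  multiplicity-self : ∀ {p} (S : ℕ → Subset p) k → k < T → 1 ≤ multiplicity S (S k)
  multiplicity-self S k k<T = subst (_≤ multiplicity S (S k)) (when?-yes refl (S k ≟ˢ S k) 1)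
    (term≤∑ {λ k′ → when? (S k′ ≟ˢ S k) 1} 0 T k z≤n k<T)

  blockSize : ∀ {p} → (ℕ → Subset p) → ℕ → ℕ
  blockSize S j = ∑ (j * l) l (λ k → ∣ S k ∣)

  blockUnion : ∀ {p} → (ℕ → Subset p) → ℕ → Subset p
  blockUnion S j = ⋃ (applyUpTo (λ t → S (j * l + t)) l)

  ⋃-∷ : ∀ {p} n (b : ℕ → Bool) (X : ℕ → Subset p) →
        ⋃ (applyUpTo (λ t → b t ∷ X t) n) ≡ or (applyUpTo b n) ∷ ⋃ (applyUpTo X n)
  ⋃-∷ zero    b X = refl
  ⋃-∷ (suc n) b X rewrite ⋃-∷ n (λ t → b (suc t)) (λ t → X (suc t)) = refl

  or≡1⊓∑ : ∀ n (b : ℕ → Bool) → when (or (applyUpTo b n)) 1 ≡ 1 ⊓ ∑ 0 n (λ t → when (b t) 1)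
  or≡1⊓∑ zero    b = refl
  or≡1⊓∑ (suc n) b with b 0
  ... | true  = refl
  ... | false = trans (or≡1⊓∑ n (λ t → b (suc t))) (cong (1 ⊓_) (sym (∑-shift 0 n (λ t → when (b t) 1))))

  ∣⋃-∷∣ : ∀ {p} n (b : ℕ → Bool) (X : ℕ → Subset p) →
          ∣ ⋃ (applyUpTo (λ t → b t ∷ X t) n) ∣ ≡ 1 ⊓ ∑ 0 n (λ t → when (b t) 1) + ∣ ⋃ (applyUpTo X n) ∣
  ∣⋃-∷∣ n b X rewrite ⋃-∷ n b X =
    trans (∣∷∣ (or (applyUpTo b n)) (⋃ (applyUpTo X n))) (cong (_+ ∣ ⋃ (applyUpTo X n) ∣) (or≡1⊓∑ n b))
    where
    ∣∷∣ : ∀ {p} c (Y : Subset p) → ∣ c ∷ Y ∣ ≡ when c 1 + ∣ Y ∣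
    ∣∷∣ true  Y = refl
    ∣∷∣ false Y = refl

  -- For a full block of total size σ whose union has c of the first p elements: while l r ≤ m its
  -- members are disjoint and it has missed at most m - l r elements; otherwise it has missed none and
  -- its remaining capacity l r - σ is at least the number m - p of elements still to come.
  Coverage : ℕ → ℕ → ℕ → Set
  Coverage p σ c = (l * r ≤ m → σ ≡ c × p ≤ c + (m ∸ l * r)) × (m < l * r → c ≡ p × σ + m ≤ p + l * r)

  record Invariant (p : ℕ) (S : ℕ → Subset p) : Set where
    field
      p≤m           : p ≤ m
      size≤r        : ∀ k → k < T → ∣ S k ∣ ≤ r
      multiplicity≡ : ∀ X → ∣ X ∣ ≤ r → multiplicity S X ≡ (m ∸ p) C (r ∸ ∣ X ∣)
      coverage      : ∀ j → j < d → Coverage p (blockSize S j) ∣ blockUnion S j ∣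

  empty-invariant : Invariant 0 (λ _ → [])
  empty-invariant = record
    { p≤m           = z≤n
    ; size≤r        = λ _ _ → z≤n
    ; multiplicity≡ = λ { [] _ → trans (∑-cong′ 0 T (λ _ → when?-yes refl ([] ≟ˢ []) 1))
                                       (trans (∑-const 0 T 1) (*-identityʳ T)) }
    ; coverage      = λ j _ → (λ _ → trans (σ≡0 {j}) (sym (c≡0 j)) , z≤n) ,
                                  (λ m<lr → c≡0 j , subst (λ σ → σ + m ≤ l * r) (sym (σ≡0 {j})) (<⇒≤ m<lr))
    }
    where
    σ≡0 : ∀ {j} → blockSize (λ _ → []) j ≡ 0
    σ≡0 {j} = ∑-zero (j * l) l (λ _ _ _ → refl)
    c≡0 : ∀ j → ∣ blockUnion (λ _ → []) j ∣ ≡ 0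
    c≡0 j with blockUnion (λ _ → []) j
    ... | [] = refl

  -- Distributing element p + 1: a slot with partial set S k receives it with "probability"
  -- (r - |S k|) / (m - p); rounding these fractions decides which slots actually receive it.
  module Extend {p} (S : ℕ → Subset p) (inv : Invariant p S) (N′ : ℕ) (remaining : m ∸ p ≡ suc N′) where
    open Invariant inv

    N : ℕ
    N = suc N′

    deficit : ℕ → ℕ
    deficit j = ∑ 0 T (λ k → when? (k / l ≟ j) (r ∸ ∣ S k ∣))

    pad : ℕ → ℕ
    pad j = (N ∸ deficit j % N) % N

    -- edges: the slots k < T, joining block k / l to the type S k, then one padding edge for each block t ≤ d
    E : ℕ
    E = T + suc d

    slotOrPad : ∀ {A : Set} → (ℕ → A) → (ℕ → A) → ℕ → A
    slotOrPad f g e with e <? T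
    ... | yes _ = f e
    ... | no  _ = g (e ∸ T)

    at-slot : ∀ {A : Set} (f g : ℕ → A) k → k < T → slotOrPad f g k ≡ f k
    at-slot f g k k<T with k <? T
    ... | yes _   = refl
    ... | no  k≮T = ⊥-elim (k≮T k<T)

    at-pad : ∀ {A : Set} (f g : ℕ → A) t → slotOrPad f g (T + t) ≡ g t
    at-pad f g t with T + t <? T
    ... | yes T+t<T = ⊥-elim (<-irrefl refl (≤-<-trans (m≤m+n T t) T+t<T))
    ... | no  _     = cong g (m+n∸m≡n T t)

    block : ℕ → ℕ
    block = slotOrPad (_/ l) (λ t → t)

    type : ℕ → Maybe (Subset p)
    type = slotOrPad (λ k → just (S k)) (λ _ → nothing)

    weight : ℕ → ℕ
    weight = slotOrPad (λ k → r ∸ ∣ S k ∣) pad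

    _≟ᵗ_ : DecidableEquality (Maybe (Subset p))
    _≟ᵗ_ = ≡-dec _≟ˢ_

    open Rounding _≟_ _≟ᵗ_ E block type N z<s

    ∑-edges : ∀ F → ∑ 0 E F ≡ ∑ 0 T F + ∑ 0 (suc d) (λ t → F (T + t))
    ∑-edges F = trans (∑-++ 0 T (suc d) F) (cong (∑ 0 T F +_) (∑-from-0 T (suc d) F))

    block-load : ∀ h j → load h (inj₁ j) ≡
                 ∑ 0 T (λ k → when? (k / l ≟ j) (h k)) + ∑ 0 (suc d) (λ t → when? (t ≟ j) (h (T + t)))
    block-load h j = trans (load-row h j) (trans (∑-edges _) (cong₂ _+_ (∑-cong 0 T slots) (∑-cong′ 0 (suc d) pads)))
      where
      slots : ∀ k → 0 ≤ k → k < 0 + T → when? (block k ≟ j) (h k) ≡ when? (k / l ≟ j) (h k)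
      slots k _ k<T = cong (λ b → when? (b ≟ j) (h k)) (at-slot _ _ k k<T)
      pads : ∀ t → when? (block (T + t) ≟ j) (h (T + t)) ≡ when? (t ≟ j) (h (T + t))
      pads t = cong (λ b → when? (b ≟ j) (h (T + t))) (at-pad _ _ t)

    type-load : ∀ h X → load h (inj₂ (just X)) ≡ ∑ 0 T (λ k → when? (S k ≟ˢ X) (h k))
    type-load h X = trans (load-col h (just X)) (trans (∑-edges _)
      (trans (cong₂ _+_ (∑-cong 0 T slots) (∑-zero 0 (suc d) (λ t _ _ → pads t))) (+-identityʳ _)))
      where
      slots : ∀ k → 0 ≤ k → k < 0 + T → when? (type k ≟ᵗ just X) (h k) ≡ when? (S k ≟ˢ X) (h k)
      slots k _ k<T rewrite at-slot (λ k → just (S k)) (λ _ → nothing) k k<T with S k ≟ˢ X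
      ... | yes _ = refl
      ... | no  _ = refl
      pads : ∀ t → when? (type (T + t) ≟ᵗ just X) (h (T + t)) ≡ 0
      pads t rewrite at-pad (λ k → just (S k)) (λ _ → nothing) t = refl

    padding-load : ∀ h → load h (inj₂ nothing) ≡ ∑ 0 (suc d) (λ t → h (T + t))
    padding-load h = trans (load-col h nothing) (trans (∑-edges _) (cong₂ _+_ (∑-zero 0 T slots) (∑-cong′ 0 (suc d) pads)))
      where
      slots : ∀ k → 0 ≤ k → k < 0 + T → when? (type k ≟ᵗ nothing) (h k) ≡ 0
      slots k _ k<T rewrite at-slot (λ k → just (S k)) (λ _ → nothing) k k<T = refl
      pads : ∀ t → when? (type (T + t) ≟ᵗ nothing) (h (T + t)) ≡ h (T + t)
      pads t rewrite at-pad (λ k → just (S k)) (λ _ → nothing) t = refl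

    slot-weight : ∀ k → k < T → weight k ≡ r ∸ ∣ S k ∣
    slot-weight = at-slot (λ k → r ∸ ∣ S k ∣) pad

    pad-weight : ∀ t → weight (T + t) ≡ pad t
    pad-weight = at-pad (λ k → r ∸ ∣ S k ∣) pad

    multiplicity≡N : ∀ X → ∣ X ∣ ≤ r → multiplicity S X ≡ N C (r ∸ ∣ X ∣)
    multiplicity≡N X X≤r = trans (multiplicity≡ X X≤r) (cong (_C (r ∸ ∣ X ∣)) remaining)

    multiplicity-big : ∀ X → r < ∣ X ∣ → multiplicity S X ≡ 0
    multiplicity-big X r<X = ∑-zero 0 T other-type
      where
      other-type : ∀ k → 0 ≤ k → k < 0 + T → when? (S k ≟ˢ X) 1 ≡ 0
      other-type k _ k<T with S k ≟ˢ X
      ... | yes refl = ⊥-elim (<-irrefl refl (<-≤-trans r<X (size≤r k k<T)))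
      ... | no  _    = refl

    type-weight : ∀ X → load weight (inj₂ (just X)) ≡ multiplicity S X * (r ∸ ∣ X ∣)
    type-weight X = begin
      load weight (inj₂ (just X))                            ≡⟨ type-load weight X ⟩
      ∑ 0 T (λ k → when? (S k ≟ˢ X) (weight k))              ≡⟨ ∑-cong 0 T same-type ⟩
      ∑ 0 T (λ k → when? (S k ≟ˢ X) (r ∸ ∣ X ∣))             ≡⟨ ∑-of-type S X (r ∸ ∣ X ∣) ⟩
      multiplicity S X * (r ∸ ∣ X ∣)                         ∎
      where
      open ≡-Reasoning
      same-type : ∀ k → 0 ≤ k → k < 0 + T → when? (S k ≟ˢ X) (weight k) ≡ when? (S k ≟ˢ X) (r ∸ ∣ X ∣)
      same-type k _ k<T rewrite slot-weight k k<T with S k ≟ˢ X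
      ... | yes refl = refl
      ... | no  _    = refl

    -- each type X occurs N C (r - |X|) times and absorption makes (r - |X|) N C (r - |X|) a multiple of N
    type-divisible : ∀ X → N ∣ multiplicity S X * (r ∸ ∣ X ∣)
    type-divisible X with ∣ X ∣ ≤? r
    ... | no  X≰r = subst (λ μ → N ∣ μ * (r ∸ ∣ X ∣)) (sym (multiplicity-big X (≰⇒> X≰r))) (divides 0 refl)
    ... | yes X≤r rewrite multiplicity≡N X X≤r with r ∸ ∣ X ∣
    ...   | zero  = divides 0 (*-zeroʳ (N C 0))
    ...   | suc q = divides (N′ C q) (trans ([1+n]C[1+k]*[1+k]≡[1+n]*nCk N′ q) (*-comm N (N′ C q)))

    weight≤N : ∀ e → weight e ≤ N
    weight≤N e with e <? T
    ... | no  _   = <⇒≤ (m%n<n (N ∸ deficit (e ∸ T) % N) N)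
    ... | yes e<T with r ∸ ∣ S e ∣ ≤? N
    ...   | yes ≤N = ≤N
    ...   | no  ≰N = ⊥-elim (<-irrefl (sym (trans (multiplicity≡N (S e) (size≤r e e<T)) (k>n⇒nCk≡0 (≰⇒> ≰N))))
                                      (multiplicity-self S e e<T))

    block-weight : ∀ j → load weight (inj₁ j) ≡ deficit j + ∑ 0 (suc d) (λ t → when? (t ≟ j) (pad t))
    block-weight j = trans (block-load weight j) (cong₂ _+_
      (∑-cong 0 T (λ k _ k<T → cong (when? (k / l ≟ j)) (slot-weight k k<T)))
      (∑-cong′ 0 (suc d) (λ t → cong (when? (t ≟ j)) (pad-weight t))))

    block-divisible : ∀ j → N ∣ load weight (inj₁ j)
    block-divisible j with j ≤? d
    ... | yes j≤d = subst (N ∣_)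
                          (sym (trans (block-weight j) (cong (deficit j +_) (∑-point 0 (suc d) j pad z≤n (s≤s j≤d)))))
                          (+pad-∣ N (deficit j))
    ... | no  j≰d = subst (N ∣_) (sym (trans (block-weight j) (cong₂ _+_ (∑-zero 0 T no-slot) (∑-zero 0 (suc d) no-pad))))
                          (divides 0 refl)
      where
      no-slot : ∀ k → 0 ≤ k → k < 0 + T → when? (k / l ≟ j) (r ∸ ∣ S k ∣) ≡ 0
      no-slot k _ k<T with k / l ≟ j
      ... | yes refl = ⊥-elim (j≰d (block≤d k k<T))
      ... | no  _    = refl
      no-pad : ∀ t → 0 ≤ t → t < 0 + suc d → when? (t ≟ j) (pad t) ≡ 0
      no-pad t _ t≤d with t ≟ j
      ... | yes refl = ⊥-elim (j≰d (≤-pred t≤d))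
      ... | no  _    = refl

    deficits-total : ∑ 0 (suc d) deficit ≡ ∑ 0 T (λ k → r ∸ ∣ S k ∣)
    deficits-total = trans (∑-comm 0 (suc d) 0 T _) (∑-cong 0 T (λ k _ k<T →
      trans (∑-cong′ 0 (suc d) (λ t → when?-≟-sym (k / l) t _)) (∑-point 0 (suc d) (k / l) _ z≤n (s≤s (block≤d k k<T)))))

    -- the total weight is a multiple of N, hence so is the load of the padding vertex
    padding-divisible : N ∣ load weight (inj₂ nothing)
    padding-divisible = subst (N ∣_) (sym (trans (padding-load weight) (∑-cong′ 0 (suc d) pad-weight)))
      (∣m+n∣m⇒∣n (subst (N ∣_) (∑-distrib-+ 0 (suc d) deficit pad) (∑-∣ 0 (suc d) (λ t _ _ → +pad-∣ N (deficit t))))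
                 (subst (N ∣_) (sym (trans deficits-total (slots-by-type S (λ X → r ∸ ∣ X ∣))))
                        (∑ˢ-∣ _ type-divisible)))

    balanced : Balanced weight
    balanced = record
      { bounded   = weight≤N
      ; divisible = λ { (inj₁ j) → block-divisible j
                      ; (inj₂ (just X)) → subst (N ∣_) (sym (type-weight X)) (type-divisible X)
                      ; (inj₂ nothing) → padding-divisible }
      }

    abstract
      rounded : Σ (ℕ → Bool) (Rounds weight)
      rounded = round weight balanced

    chosen : ℕ → Bool
    chosen = proj₁ rounded

    chosen-loads : ∀ v → load (scaled chosen) v ≡ load weight v
    chosen-loads = proj₁ (proj₂ rounded)

    chosen-nonzero : ∀ e → weight e ≡ 0 → chosen e ≡ false
    chosen-nonzero = proj₂ (proj₂ rounded)

    S′ : ℕ → Subset (suc p)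
    S′ k = chosen k ∷ S k

    size≤r′ : ∀ k → k < T → ∣ S′ k ∣ ≤ r
    size≤r′ k k<T with chosen k in chosen-k
    ... | false = size≤r k k<T
    ... | true with ∣ S k ∣ <? r
    ...   | yes S<r = S<r
    ...   | no  S≮r = ⊥-elim (true≢false (trans (sym chosen-k)
              (chosen-nonzero k (trans (slot-weight k k<T) (m≤n⇒m∸n≡0 (≮⇒≥ S≮r))))))
      where
      true≢false : true ≢ false
      true≢false ()

    chosenOfType : Subset p → ℕ
    chosenOfType X = ∑ 0 T (λ k → when? (S k ≟ˢ X) (when (chosen k) 1))

    N*chosenOfType : ∀ X → N * chosenOfType X ≡ multiplicity S X * (r ∸ ∣ X ∣)
    N*chosenOfType X = begin
      N * chosenOfType X                                     ≡⟨ ∑-*ˡ 0 T N _ ⟨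
      ∑ 0 T (λ k → N * when? (S k ≟ˢ X) (when (chosen k) 1)) ≡⟨ ∑-cong′ 0 T scale ⟨
      ∑ 0 T (λ k → when? (S k ≟ˢ X) (scaled chosen k))       ≡⟨ type-load (scaled chosen) X ⟨
      load (scaled chosen) (inj₂ (just X))                   ≡⟨ chosen-loads (inj₂ (just X)) ⟩
      load weight (inj₂ (just X))                            ≡⟨ type-weight X ⟩
      multiplicity S X * (r ∸ ∣ X ∣)                         ∎
      where
      open ≡-Reasoning
      scale : ∀ k → when? (S k ≟ˢ X) (scaled chosen k) ≡ N * when? (S k ≟ˢ X) (when (chosen k) 1)
      scale k with S k ≟ˢ X | chosen k
      ... | yes _ | true  = sym (*-identityʳ N)
      ... | yes _ | false = sym (*-zeroʳ N)
      ... | no  _ | _     = sym (*-zeroʳ N)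

    multiplicity-chosen : ∀ X → multiplicity S′ (true ∷ X) ≡ chosenOfType X
    multiplicity-chosen X =
      ∑-cong′ 0 T (λ k → trans (when?-∷ (chosen k) (S k) true X 1) (cong (when? (S k ≟ˢ X)) (bit (chosen k))))
      where
      bit : ∀ c → when? (c Bool.≟ true) 1 ≡ when c 1
      bit true  = refl
      bit false = refl

    multiplicity-split : ∀ X → multiplicity S X ≡ chosenOfType X + multiplicity S′ (false ∷ X)
    multiplicity-split X = trans (∑-cong′ 0 T split) (∑-distrib-+ 0 T _ _)
      where
      split : ∀ k → when? (S k ≟ˢ X) 1 ≡
                    when? (S k ≟ˢ X) (when (chosen k) 1) + when? ((chosen k ∷ S k) ≟ˢ (false ∷ X)) 1
      split k rewrite when?-∷ (chosen k) (S k) false X 1 with S k ≟ˢ X | chosen k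
      ... | yes _ | true  = refl
      ... | yes _ | false = refl
      ... | no  _ | true  = refl
      ... | no  _ | false = refl

    m∸[1+p]≡N′ : m ∸ suc p ≡ N′
    m∸[1+p]≡N′ = trans (sym (pred[m∸n]≡m∸[1+n] m p)) (cong pred remaining)

    none-chosen : ∀ X → r ∸ ∣ X ∣ ≡ 0 → chosenOfType X ≡ 0
    none-chosen X full = *-cancelˡ-≡ _ _ N (begin
      N * chosenOfType X                      ≡⟨ N*chosenOfType X ⟩
      multiplicity S X * (r ∸ ∣ X ∣)          ≡⟨ cong (multiplicity S X *_) full ⟩
      multiplicity S X * 0                    ≡⟨ *-zeroʳ (multiplicity S X) ⟩
      0                                       ≡⟨ *-zeroʳ N ⟨
      N * 0                                   ∎)
      where open ≡-Reasoning

    chosenOfType≡ : ∀ X q → ∣ X ∣ ≤ r → r ∸ ∣ X ∣ ≡ suc q → chosenOfType X ≡ N′ C q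
    chosenOfType≡ X q X≤r eq = *-cancelˡ-≡ _ _ N (begin
      N * chosenOfType X                      ≡⟨ N*chosenOfType X ⟩
      multiplicity S X * (r ∸ ∣ X ∣)          ≡⟨ cong₂ _*_ (multiplicity≡N X X≤r) eq ⟩
      (N C (r ∸ ∣ X ∣)) * suc q               ≡⟨ cong (λ x → (N C x) * suc q) eq ⟩
      (N C suc q) * suc q                     ≡⟨ [1+n]C[1+k]*[1+k]≡[1+n]*nCk N′ q ⟩
      N * (N′ C q)                            ∎)
      where open ≡-Reasoning

    multiplicity≡′ : ∀ X′ → ∣ X′ ∣ ≤ r → multiplicity S′ X′ ≡ (m ∸ suc p) C (r ∸ ∣ X′ ∣)
    multiplicity≡′ (true ∷ X) X<r = begin
      multiplicity S′ (true ∷ X)               ≡⟨ multiplicity-chosen X ⟩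
      chosenOfType X                           ≡⟨ chosenOfType≡ X (r ∸ suc ∣ X ∣) (<⇒≤ X<r) (+-∸-assoc 1 X<r) ⟩
      N′ C (r ∸ suc ∣ X ∣)                     ≡⟨ cong (_C (r ∸ suc ∣ X ∣)) m∸[1+p]≡N′ ⟨
      (m ∸ suc p) C (r ∸ suc ∣ X ∣)            ∎
      where open ≡-Reasoning
    multiplicity≡′ (false ∷ X) X≤r = +-cancelˡ-≡ (chosenOfType X) _ _ (begin
      chosenOfType X + multiplicity S′ (false ∷ X)   ≡⟨ multiplicity-split X ⟨
      multiplicity S X                               ≡⟨ multiplicity≡N X X≤r ⟩
      N C (r ∸ ∣ X ∣)                                ≡⟨ pascal (r ∸ ∣ X ∣) refl ⟩
      chosenOfType X + (m ∸ suc p) C (r ∸ ∣ X ∣)     ∎)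
      where
      open ≡-Reasoning
      pascal : ∀ q → r ∸ ∣ X ∣ ≡ q → N C q ≡ chosenOfType X + (m ∸ suc p) C q
      pascal zero    eq = cong (_+ (m ∸ suc p) C 0) (sym (none-chosen X eq))
      pascal (suc q) eq = trans (sym (nCk+nC[k+1]≡[n+1]C[k+1] N′ q))
        (cong₂ _+_ (sym (chosenOfType≡ X q X≤r eq)) (cong (_C suc q) (sym m∸[1+p]≡N′)))

    N+p≡m : N + p ≡ m
    N+p≡m = trans (cong (_+ p) (sym remaining)) (m∸n+n≡m p≤m)

    chosenIn : ℕ → ℕ
    chosenIn j = ∑ (j * l) l (λ k → when (chosen k) 1)

    deficit+blockSize : ∀ j → j < d → deficit j + blockSize S j ≡ l * r
    deficit+blockSize j j<d = begin
      deficit j + blockSize S j                                 ≡⟨ cong (_+ blockSize S j) (∑-block j j<d _) ⟩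
      ∑ (j * l) l (λ k → r ∸ ∣ S k ∣) + blockSize S j           ≡⟨ ∑-distrib-+ (j * l) l (λ k → r ∸ ∣ S k ∣) (λ k → ∣ S k ∣) ⟨
      ∑ (j * l) l (λ k → r ∸ ∣ S k ∣ + ∣ S k ∣)                 ≡⟨ ∑-cong (j * l) l (λ k _ k< → m∸n+n≡m (size≤r k (in-slots k k<))) ⟩
      ∑ (j * l) l (λ _ → r)                                     ≡⟨ ∑-const (j * l) l r ⟩
      l * r                                                     ∎
      where
      open ≡-Reasoning
      in-slots : ∀ k → k < j * l + l → k < T
      in-slots k k< = <-≤-trans k< (full-block≤T j j<d)

    block-chosen : ∀ j → j < d → N * chosenIn j + when (chosen (T + j)) N ≡ deficit j + pad j
    block-chosen j j<d = begin
      N * chosenIn j + when (chosen (T + j)) N                ≡⟨ cong₂ _+_ slots pads ⟨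
      ∑ (j * l) l (scaled chosen) + ∑ 0 (suc d) (λ t → when? (t ≟ j) (scaled chosen (T + t)))
        ≡⟨ cong (_+ ∑ 0 (suc d) (λ t → when? (t ≟ j) (scaled chosen (T + t)))) (∑-block j j<d (scaled chosen)) ⟨
      ∑ 0 T (λ k → when? (k / l ≟ j) (scaled chosen k)) + ∑ 0 (suc d) (λ t → when? (t ≟ j) (scaled chosen (T + t)))
        ≡⟨ block-load (scaled chosen) j ⟨
      load (scaled chosen) (inj₁ j)           ≡⟨ chosen-loads (inj₁ j) ⟩
      load weight (inj₁ j)                    ≡⟨ block-weight j ⟩
      deficit j + ∑ 0 (suc d) (λ t → when? (t ≟ j) (pad t))
        ≡⟨ cong (deficit j +_) (∑-point 0 (suc d) j pad z≤n (s≤s (<⇒≤ j<d))) ⟩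
      deficit j + pad j                       ∎
      where
      open ≡-Reasoning
      N*when : ∀ c → N * when c 1 ≡ when c N
      N*when true  = *-identityʳ N
      N*when false = *-zeroʳ N
      slots : ∑ (j * l) l (scaled chosen) ≡ N * chosenIn j
      slots = trans (sym (∑-cong′ (j * l) l (λ k → N*when (chosen k)))) (∑-*ˡ (j * l) l N _)
      pads : ∑ 0 (suc d) (λ t → when? (t ≟ j) (scaled chosen (T + t))) ≡ when (chosen (T + j)) N
      pads = ∑-point 0 (suc d) j (λ t → scaled chosen (T + t)) z≤n (s≤s (<⇒≤ j<d))

    chosenIn-rounds : ∀ j → j < d → deficit j < N * chosenIn j + N × N * chosenIn j < deficit j + N
    chosenIn-rounds j j<d = rounding-bounds N (chosenIn j) (deficit j) (pad j) (chosen (T + j)) (m%n<n (N ∸ deficit j % N) N)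
      (λ pad≡0 → chosen-nonzero (T + j) (trans (pad-weight j) pad≡0)) (block-chosen j j<d)

    blockSize′ : ∀ j → blockSize S′ j ≡ chosenIn j + blockSize S j
    blockSize′ j = trans (∑-cong′ (j * l) l (λ k → ∣∷∣ (chosen k) (S k)))
                         (∑-distrib-+ (j * l) l (λ k → when (chosen k) 1) (λ k → ∣ S k ∣))
      where
      ∣∷∣ : ∀ c (Y : Subset p) → ∣ c ∷ Y ∣ ≡ when c 1 + ∣ Y ∣
      ∣∷∣ true  Y = refl
      ∣∷∣ false Y = refl

    blockUnion′ : ∀ j → ∣ blockUnion S′ j ∣ ≡ 1 ⊓ chosenIn j + ∣ blockUnion S j ∣
    blockUnion′ j = trans (∣⋃-∷∣ l (λ t → chosen (j * l + t)) (λ t → S (j * l + t)))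
      (cong (λ s → 1 ⊓ s + ∣ blockUnion S j ∣) (sym (∑-from-0 (j * l) l (λ k → when (chosen k) 1))))

    coverage′ : ∀ j → j < d → Coverage (suc p) (blockSize S′ j) ∣ blockUnion S′ j ∣
    coverage′ j j<d rewrite blockSize′ j | blockUnion′ j = disjoint , covering
      where
      bounds = chosenIn-rounds j j<d
      σ = blockSize S j
      c = ∣ blockUnion S j ∣
      disjoint : l * r ≤ m → chosenIn j + σ ≡ 1 ⊓ chosenIn j + c × suc p ≤ 1 ⊓ chosenIn j + c + (m ∸ l * r)
      disjoint lr≤m with proj₁ (coverage j j<d) lr≤m
      ... | σ≡c , p≤ with disjoint-choice (trans N+p≡m (sym (m+[n∸m]≡n lr≤m))) (deficit+blockSize j j<d)
                            (subst (λ x → p ≤ x + (m ∸ l * r)) (sym σ≡c) p≤) (proj₁ bounds) (proj₂ bounds)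
      ...   | inj₁ (s≡0 , p<) rewrite s≡0 = σ≡c , subst (λ x → p < x + (m ∸ l * r)) σ≡c p<
      ...   | inj₂ s≡1        rewrite s≡1 = cong suc σ≡c , s≤s p≤
      covering : m < l * r → 1 ⊓ chosenIn j + c ≡ suc p × chosenIn j + σ + m ≤ suc p + l * r
      covering m<lr with proj₂ (coverage j j<d) m<lr
      ... | c≡p , σ+m≤ with covering-choice z<s (sym N+p≡m) (deficit+blockSize j j<d) σ+m≤ (proj₁ bounds) (proj₂ bounds)
      ...   | 1≤s , bound = cong₂ _+_ (m≤n⇒m⊓n≡m 1≤s) c≡p , bound

    invariant′ : Invariant (suc p) S′
    invariant′ = record
      { p≤m           = subst (suc p ≤_) N+p≡m (s≤s (m≤n+m p N′))
      ; size≤r        = size≤r′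
      ; multiplicity≡ = multiplicity≡′
      ; coverage      = coverage′
      }

  construction : ∀ p → p ≤ m → Σ (ℕ → Subset p) (Invariant p)
  construction zero    _   = (λ _ → []) , empty-invariant
  construction (suc p) p<m with construction p (<⇒≤ p<m)
  ... | S , inv = Extend.S′ S inv (m ∸ suc p) remaining , Extend.invariant′ S inv (m ∸ suc p) remaining
    where
    remaining : m ∸ p ≡ suc (m ∸ suc p)
    remaining = +-∸-assoc 1 p<m

  family : ℕ → Subset m
  family = proj₁ (construction m ≤-refl)

  private
    complete : Invariant m family
    complete = proj₂ (construction m ≤-refl)

    open Invariant complete

    multiplicity-final : ∀ X → ∣ X ∣ ≤ r → multiplicity family X ≡ 0 C (r ∸ ∣ X ∣)
    multiplicity-final X X≤r = trans (multiplicity≡ X X≤r) (cong (_C (r ∸ ∣ X ∣)) (n∸n≡0 m))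

  family-size : ∀ k → k < T → ∣ family k ∣ ≡ r
  family-size k k<T = ≤-antisym (size≤r k k<T) (m∸n≡0⇒m≤n (full (r ∸ ∣ family k ∣) refl))
    where
    full : ∀ q → r ∸ ∣ family k ∣ ≡ q → r ∸ ∣ family k ∣ ≡ 0
    full zero    eq = eq
    full (suc q) eq = ⊥-elim (<-irrefl (sym (trans (multiplicity-final (family k) (size≤r k k<T)) (cong (0 C_) eq)))
                                      (multiplicity-self family k k<T))

  multiplicity-exact : ∀ X → ∣ X ∣ ≡ r → multiplicity family X ≡ 1
  multiplicity-exact X X≡r = begin
    multiplicity family X     ≡⟨ multiplicity-final X (≤-reflexive X≡r) ⟩
    0 C (r ∸ ∣ X ∣)           ≡⟨ cong (λ x → 0 C (r ∸ x)) X≡r ⟩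
    0 C (r ∸ r)               ≡⟨ cong (0 C_) (n∸n≡0 r) ⟩
    1                         ∎
    where open ≡-Reasoning

  family-injective : ∀ {k k′} → k < k′ → k′ < T → family k ≢ family k′
  family-injective {k} {k′} k<k′ k′<T same = <-irrefl refl (begin-strict
    1                                                                   <⟨ s≤s (s≤s z≤n) ⟩
    2                                                                   ≡⟨ cong₂ _+_ (when?-yes refl (family k ≟ˢ family k) 1)
                                                                                     (when?-yes (sym same) (family k′ ≟ˢ family k) 1) ⟨
    when? (family k ≟ˢ family k) 1 + when? (family k′ ≟ˢ family k) 1   ≤⟨ two-terms≤∑ 0 T k k′ z≤n (<-trans k<k′ k′<T) z≤n k′<T (<⇒≢ k<k′) ⟩
    multiplicity family (family k)                                      ≡⟨ multiplicity-exact (family k) (family-size k (<-trans k<k′ k′<T)) ⟩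
    1                                                                   ∎)
    where open ≤-Reasoning

  family-surjective : ∀ X → ∣ X ∣ ≡ r → Σ ℕ λ k → k < T × family k ≡ X
  family-surjective X X≡r
    with ∑-pos 0 T (λ k → when? (family k ≟ˢ X) 1) (subst (0 <_) (sym (multiplicity-exact X X≡r)) z<s)
  ... | k , _ , k<T , hit with family k ≟ˢ X
  ...   | yes eq = k , k<T , eq
  ...   | no  _  = ⊥-elim (<-irrefl refl hit)

  family-covers : ∀ j → j < d → m ⊓ (l * r) ≤ ∣ blockUnion family j ∣
  family-covers j j<d with l * r ≤? m
  ... | yes lr≤m = ≤-trans (m⊓n≤n m (l * r)) (+-cancelʳ-≤ (m ∸ l * r) (l * r) _
          (subst (_≤ ∣ blockUnion family j ∣ + (m ∸ l * r)) (sym (m+[n∸m]≡n lr≤m))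
                 (proj₂ (proj₁ (coverage j j<d) lr≤m))))
  ... | no  lr≰m = ≤-trans (m⊓n≤m m (l * r)) (≤-reflexive (sym (proj₁ (proj₂ (coverage j j<d) (≰⇒> lr≰m)))))

open import Data.Bool using (true; false)
open import Data.Fin using (Fin; zero; suc; toℕ)
open import Data.Fin.Properties using (toℕ<n)
open import Data.Fin.Subset using (Subset; ∣_∣; ⋃; _∪_)
import Data.Fin.Subset as FS
open import Data.Fin.Subset.Properties using (∪-identityʳ)
open import Data.List using (List; []; _∷_; length; concat; map; allFin; tabulate; applyUpTo; _++_)
open import Data.List.Properties using (length-applyUpTo; map-tabulate; map-applyUpTo; tabulate-cong)
open import Data.List.Membership.Propositional using (_∈_)
open import Data.List.Membership.Propositional.Properties using (∈-applyUpTo⁺; ∈-applyUpTo⁻)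
open import Data.List.Relation.Unary.Unique.Propositional using (Unique)
open import Data.List.Relation.Unary.Unique.Propositional.Properties using (applyUpTo⁺₁)
open import Data.Nat using (ℕ; zero; suc; _≤_; _∸_; _+_; _*_; _⊓_; _/_; >-nonZero; s≤s; z≤n)
open import Data.Nat.Combinatorics using (_C_)
open import Data.Nat.DivMod using (m/n*n≤m)
open import Data.Nat.Properties
open import Data.Product using (Σ; _×_; _,_)
open import Data.Vec using ([]; _∷_; replicate; here; there)
import Data.Vec as Vec
open import Data.Vec.Properties using (∷-injectiveʳ; ++-injectiveʳ)
open import Function.Bundles using (_⇔_; mk⇔)
open import Relation.Binary.PropositionalEquality
open import Defs

private
  variable
    A : Set

applyUpTo-cong : ∀ {f g : ℕ → A} n → (∀ t → f t ≡ g t) → applyUpTo f n ≡ applyUpTo g n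
applyUpTo-cong zero    eq = refl
applyUpTo-cong (suc n) eq = cong₂ _∷_ (eq 0) (applyUpTo-cong n (λ t → eq (suc t)))

applyUpTo-++ : ∀ (f : ℕ → A) m n → applyUpTo f (m + n) ≡ applyUpTo f m ++ applyUpTo (λ t → f (m + t)) n
applyUpTo-++ f zero    n = refl
applyUpTo-++ f (suc m) n = cong (f 0 ∷_) (applyUpTo-++ (λ t → f (suc t)) m n)

concat-blocks : ∀ (f : ℕ → A) l d →
                concat (tabulate {n = d} (λ j → applyUpTo (λ t → f (toℕ j * l + t)) l)) ≡ applyUpTo f (d * l)
concat-blocks f l zero    = refl
concat-blocks f l (suc d) = begin
  applyUpTo f l ++ concat (tabulate {n = d} (λ j → applyUpTo (λ t → f (l + toℕ j * l + t)) l))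
    ≡⟨ cong (λ bs → applyUpTo f l ++ concat bs)
            (tabulate-cong {n = d} (λ j → applyUpTo-cong l (λ t → cong f (+-assoc l (toℕ j * l) t)))) ⟩
  applyUpTo f l ++ concat (tabulate {n = d} (λ j → applyUpTo (λ t → f (l + (toℕ j * l + t))) l))
    ≡⟨ cong (applyUpTo f l ++_) (concat-blocks (λ t → f (l + t)) l d) ⟩
  applyUpTo f l ++ applyUpTo (λ t → f (l + t)) (d * l)
    ≡⟨ applyUpTo-++ f l (d * l) ⟨
  applyUpTo f (l + d * l) ∎
  where
  open ≡-Reasoning

-- the k-sets with least element i = suc i′ are {i} ∪ B, with B a (k - 1)-subset of the last m labels
embed : ∀ i′ {m} → Subset m → Subset (i′ + suc m)
embed i′ B = replicate i′ false Vec.++ (true ∷ B)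

∣embed∣ : ∀ i′ {m} (B : Subset m) → ∣ embed i′ B ∣ ≡ suc ∣ B ∣
∣embed∣ zero     B = refl
∣embed∣ (suc i′) B = ∣embed∣ i′ B

embed-injective : ∀ i′ {m} {B B′ : Subset m} → embed i′ B ≡ embed i′ B′ → B ≡ B′
embed-injective i′ eq = ∷-injectiveʳ (++-injectiveʳ (replicate i′ false) (replicate i′ false) eq)

embed-∪ : ∀ i′ {m} (B B′ : Subset m) → embed i′ B ∪ embed i′ B′ ≡ embed i′ (B ∪ B′)
embed-∪ zero     B B′ = refl
embed-∪ (suc i′) B B′ = cong (false ∷_) (embed-∪ i′ B B′)

⋃-embed : ∀ i′ {m} (B : Subset m) Bs → ⋃ (map (embed i′) (B ∷ Bs)) ≡ embed i′ (⋃ (B ∷ Bs))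
⋃-embed i′ B []        = trans (∪-identityʳ (embed i′ B)) (cong (embed i′) (sym (∪-identityʳ B)))
⋃-embed i′ B (B′ ∷ Bs) = trans (cong (embed i′ B ∪_) (⋃-embed i′ B′ Bs)) (embed-∪ i′ B _)

∣⋃-embed∣ : ∀ i′ {m} (X : ℕ → Subset m) n →
            ∣ ⋃ (applyUpTo (λ t → embed i′ (X t)) (suc n)) ∣ ≡ suc ∣ ⋃ (applyUpTo X (suc n)) ∣
∣⋃-embed∣ i′ X n = begin
  ∣ ⋃ (applyUpTo (λ t → embed i′ (X t)) (suc n)) ∣           ≡⟨ cong (λ Bs → ∣ ⋃ Bs ∣) (map-applyUpTo X (embed i′) (suc n)) ⟨
  ∣ ⋃ (map (embed i′) (X 0 ∷ applyUpTo (λ t → X (suc t)) n)) ∣ ≡⟨ cong ∣_∣ (⋃-embed i′ (X 0) (applyUpTo (λ t → X (suc t)) n)) ⟩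
  ∣ embed i′ (⋃ (applyUpTo X (suc n))) ∣                      ≡⟨ ∣embed∣ i′ _ ⟩
  suc ∣ ⋃ (applyUpTo X (suc n)) ∣                             ∎
  where open ≡-Reasoning

embed-least : ∀ i′ {m} (B : Subset m) →
              (Σ (Fin (i′ + suc m)) λ x → x FS.∈ embed i′ B × label x ≡ suc i′)
              × (∀ y → y FS.∈ embed i′ B → suc i′ ≤ label y)
embed-least zero     B = (zero , here , refl) , λ _ _ → s≤s z≤n
embed-least (suc i′) B with embed-least i′ B
... | (x , x∈ , x≡) , least = (suc x , there x∈ , cong suc x≡) , λ { (suc y) (there y∈) → s≤s (least y y∈) }

embed-InFamily : ∀ i′ {m r} (B : Subset m) → ∣ B ∣ ≡ r → InFamily (i′ + suc m) (suc r) (suc i′) (embed i′ B)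
embed-InFamily i′ B B≡r = trans (∣embed∣ i′ B) (cong suc B≡r) , embed-least i′ B

InFamily-embed : ∀ i′ {m r} A → InFamily (i′ + suc m) (suc r) (suc i′) A →
                 Σ (Subset m) λ B → ∣ B ∣ ≡ r × A ≡ embed i′ B
InFamily-embed i′ A (∣A∣≡ , min , least) with decompose i′ A min least
  where
  decompose : ∀ i′ {m} (A : Subset (i′ + suc m)) → (Σ (Fin (i′ + suc m)) λ x → x FS.∈ A × label x ≡ suc i′) →
              (∀ y → y FS.∈ A → suc i′ ≤ label y) → Σ (Subset m) λ B → A ≡ embed i′ B
  decompose zero     (b ∷ B)      (zero , here , _) _ = B , refl
  decompose (suc i′) (true ∷ A)   _ least with s≤s () ← least zero here
  decompose (suc i′) (false ∷ A)  (suc x , there x∈ , x≡) least with decompose i′ A (x , x∈ , suc-injective x≡)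
                                                                        (λ y y∈ → ≤-pred (least (suc y) (there y∈)))
  ... | B , A≡ = B , cong (false ∷_) A≡
... | B , refl = B , suc-injective (trans (sym (∣embed∣ i′ B)) ∣A∣≡) , refl

-- the conclusion of lemma4 with n ∸ i abstracted to m, so that n can be rewritten
Partition : (n m k i l : ℕ) → 1 ≤ l → Set
Partition n m k i l 1≤l =
  Σ (Fin (_/_ (m C (k ∸ 1)) l {{>-nonZero 1≤l}}) → List (Subset n)) λ blocks →
  Σ (List (Subset n)) λ rest →
    (∀ j → length (blocks j) ≡ l)
  × (length rest ≡ m C (k ∸ 1) ∸ (_/_ (m C (k ∸ 1)) l {{>-nonZero 1≤l}}) * l)
  × Unique (concat (map blocks (allFin _)) ++ rest)
  × (∀ (A : Subset n) → (A ∈ (concat (map blocks (allFin _)) ++ rest)) ⇔ InFamily n k i A)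
  × (∀ j → (m + 1) ⊓ (l * (k ∸ 1) + 1) ≤ covered (blocks j))

partition : ∀ i′ m r l′ → Partition (i′ + suc m) m (suc r) (suc i′) (suc l′) (s≤s z≤n)
partition i′ m r l′ = blocks , rest , length-blocks , length-rest , unique , members , covers
  where
  open Baranyai m r l′
  member : ℕ → Subset (i′ + suc m)
  member k = embed i′ (family k)
  blocks : Fin d → List (Subset (i′ + suc m))
  blocks j = applyUpTo (λ t → member (toℕ j * l + t)) l
  rest : List (Subset (i′ + suc m))
  rest = applyUpTo (λ t → member (d * l + t)) (T ∸ d * l)
  all≡ : concat (map blocks (allFin d)) ++ rest ≡ applyUpTo member T
  all≡ = begin
    concat (map blocks (allFin d)) ++ rest      ≡⟨ cong (λ bs → concat bs ++ rest) (map-tabulate (λ j → j) blocks) ⟩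
    concat (tabulate blocks) ++ rest            ≡⟨ cong (_++ rest) (concat-blocks member l d) ⟩
    applyUpTo member (d * l) ++ rest            ≡⟨ applyUpTo-++ member (d * l) (T ∸ d * l) ⟨
    applyUpTo member (d * l + (T ∸ d * l))      ≡⟨ cong (applyUpTo member) (m+[n∸m]≡n (m/n*n≤m T l)) ⟩
    applyUpTo member T                          ∎
    where open ≡-Reasoning
  length-blocks : ∀ j → length (blocks j) ≡ l
  length-blocks j = length-applyUpTo (λ t → member (toℕ j * l + t)) l
  length-rest : length rest ≡ T ∸ d * l
  length-rest = length-applyUpTo (λ t → member (d * l + t)) (T ∸ d * l)
  unique : Unique (concat (map blocks (allFin d)) ++ rest)
  unique = subst Unique (sym all≡) (applyUpTo⁺₁ member T (λ k<k′ k′<T same →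
    family-injective k<k′ k′<T (embed-injective i′ same)))
  members : ∀ A → (A ∈ (concat (map blocks (allFin d)) ++ rest)) ⇔ InFamily (i′ + suc m) (suc r) (suc i′) A
  members A = mk⇔ to from
    where
    to : A ∈ (concat (map blocks (allFin d)) ++ rest) → InFamily (i′ + suc m) (suc r) (suc i′) A
    to A∈ with ∈-applyUpTo⁻ member (subst (A ∈_) all≡ A∈)
    ... | k , k<T , refl = embed-InFamily i′ (family k) (family-size k k<T)
    from : InFamily (i′ + suc m) (suc r) (suc i′) A → A ∈ (concat (map blocks (allFin d)) ++ rest)
    from A∈𝒜 with InFamily-embed i′ A A∈𝒜
    ... | B , ∣B∣≡r , refl with family-surjective B ∣B∣≡r
    ...   | k , k<T , refl = subst (member k ∈_) (sym all≡) (∈-applyUpTo⁺ member k<T)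
  covers : ∀ j → (m + 1) ⊓ (l * r + 1) ≤ covered (blocks j)
  covers j = begin
    (m + 1) ⊓ (l * r + 1)                 ≡⟨ +-distribʳ-⊓ 1 m (l * r) ⟨
    m ⊓ (l * r) + 1                       ≤⟨ +-monoˡ-≤ 1 (family-covers (toℕ j) (toℕ<n j)) ⟩
    ∣ blockUnion family (toℕ j) ∣ + 1      ≡⟨ +-comm _ 1 ⟩
    suc ∣ blockUnion family (toℕ j) ∣      ≡⟨ ∣⋃-embed∣ i′ (λ t → family (toℕ j * l + t)) l′ ⟨
    covered (blocks j)                    ∎
    where open ≤-Reasoning

lemma4 : (n k i l : ℕ) → 2 * k + 1 ≤ n → 7 ≤ 2 * k + 1
    → 1 ≤ i → i ≤ n ∸ k + 1
    → (1≤l : 1 ≤ l) → l ≤ (n ∸ i) C (k ∸ 1)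
    → Σ (Fin (_/_ ((n ∸ i) C (k ∸ 1)) l {{>-nonZero 1≤l}}) → List (Subset n)) λ blocks
      → Σ (List (Subset n)) λ rest
      → (∀ j → length (blocks j) ≡ l)
        × (length rest ≡ (n ∸ i) C (k ∸ 1) ∸ (_/_ ((n ∸ i) C (k ∸ 1)) l {{>-nonZero 1≤l}}) * l)
        × Unique (concat (map blocks (allFin _)) ++ rest)
        × (∀ (A : Subset n) → (A ∈ (concat (map blocks (allFin _)) ++ rest)) ⇔ InFamily n k i A)
        × (∀ j → (n ∸ i + 1) ⊓ (l * (k ∸ 1) + 1) ≤ covered (blocks j))
lemma4 n zero    i        l        _      (s≤s ())       _       _   _         _
lemma4 n (suc r) zero     l        _      _              ()      _   _         _
lemma4 n (suc r) (suc i′) zero     _      _              _       _   ()        _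
lemma4 n (suc r) (suc i′) (suc l′) 2k+1≤n _              _       i≤  (s≤s z≤n) _ =
  subst (λ n′ → Partition n′ (n ∸ suc i′) (suc r) (suc i′) (suc l′) (s≤s z≤n))
        (trans (+-suc i′ (n ∸ suc i′)) (m+[n∸m]≡n i≤n)) (partition i′ (n ∸ suc i′) r l′)
  where
  k≤n : suc r ≤ n
  k≤n = ≤-trans (≤-trans (m≤m+n (suc r) (suc r + 0)) (m≤m+n (2 * suc r) 1)) 2k+1≤n
  i≤n : suc i′ ≤ n
  i≤n = ≤-trans i≤ (≤-trans (+-monoʳ-≤ (n ∸ suc r) (s≤s z≤n)) (≤-reflexive (m∸n+n≡m k≤n)))
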